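{- Fix $b\in\mathbb{N}$. For $(r,s)\in\mathbb{N}\times\mathbb{N}$ define \[ \Lambda(r,s)=\left|\{(n,m)\in\mathbb{N}\times\mathbb{N}: (n,m)\text{ is } b\text{ -visible and } |n-r|+|m-s|=1\}\right|. \] Then the mean value $M(\Lambda)=\lim_{N\to\infty}\frac{1}{N^2}\sum_{0<r,s\le N}\Lambda(r,s)$ exists and equals $\dfrac{4}{\zeta(b+1)}$, where $\zeta$ is the Riemann zeta function.
   Context: Let $\mathbb{N}=\{1,2,3,\dots\}$. For $b\in\mathbb{N}$ and $r,s\in\mathbb{N}$, $\gcd_b(r,s)=\max\{k\in\mathbb{N}: k\mid r \text{ and } k^b\mid s\}$; a point $(r,s)\in\mathbb{N}\times\mathbb{N}$ is $b$-visible if $\gcd_b(r,s)=1$. -}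

module Defs where

open import Data.Nat using (ℕ; zero; suc; _+_; _*_; _∸_; _^_; ∣_-_∣)
open import Data.Nat.Properties using (_≟_)
open import Data.Nat.Divisibility using (_∣?_)
open import Data.Bool using (Bool; true; false; if_then_else_; _∧_)
open import Data.Integer using (+_; -[1+_])
open import Relation.Nullary.Decidable using (does)
open import Data.Rational.Unnormalised using (ℚᵘ; mkℚᵘ; 0ℚᵘ) renaming (_+_ to _+q_; _*_ to _*q_)

sum1 : ℕ → (ℕ → ℕ) → ℕ
sum1 zero    f = 0
sum1 (suc n) f = sum1 n f + f (suc n)

-- gcd_b(r,s) = max{ k : k ∣ r and k^b ∣ s }, searched downward from k = r
-- (for r ≥ 1 every such k satisfies k ≤ r, and k = 1 always qualifies).
gcdbFrom : ℕ → ℕ → ℕ → ℕ → ℕ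
gcdbFrom b r s zero    = 1
gcdbFrom b r s (suc k) =
  if does (suc k ∣? r) ∧ does (suc k ^ b ∣? s) then suc k else gcdbFrom b r s k

gcdb : ℕ → ℕ → ℕ → ℕ
gcdb b r s = gcdbFrom b r s r

visible? : ℕ → ℕ → ℕ → Bool
visible? b r s = does (gcdb b r s ≟ 1)

indicator : Bool → ℕ
indicator true  = 1
indicator false = 0

-- Λ(r,s) = #{ (n,m) ∈ ℕ⁺×ℕ⁺ : (n,m) b-visible, |n-r|+|m-s| = 1 }.
-- Any such (n,m) has 1 ≤ n ≤ r+1 and 1 ≤ m ≤ s+1, so we count over that box.
Λ : ℕ → ℕ → ℕ → ℕ
Λ b r s = sum1 (suc r) (λ n → sum1 (suc s) (λ m →
  indicator (visible? b n m ∧ does ((∣ n - r ∣ + ∣ m - s ∣) ≟ 1))))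

SumΛ : ℕ → ℕ → ℕ
SumΛ b N = sum1 N (λ r → sum1 N (λ s → Λ b r s))

-- (1/N²) Σ_{0<r,s≤N} Λ(r,s) as an unnormalised rational (meaningful for N ≥ 1)
avgΛ : ℕ → ℕ → ℚᵘ
avgΛ b N = mkℚᵘ (+ SumΛ b N) (N * N ∸ 1)

zetaPartial : ℕ → ℕ → ℚᵘ
zetaPartial b zero    = 0ℚᵘ
zetaPartial b (suc k) = zetaPartial b k +q mkℚᵘ (+ 1) (suc k ^ (b + 1) ∸ 1)

-- reciprocal of a positive rational (junk value 0 otherwise; only applied to positive values)
recip : ℚᵘ → ℚᵘ
recip (mkℚᵘ (+ suc n) d) = mkℚᵘ (+ suc d) n
recip _ = 0ℚᵘ

-- 4 / (Σ_{k=1}^{K} 1/k^{b+1}), which tends to 4/ζ(b+1) as K → ∞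
fourOverZetaPartial : ℕ → ℕ → ℚᵘ
fourOverZetaPartial b K = mkℚᵘ (+ 4) 0 *q recip (zetaPartial b K)

module Submission where

-- Write V(x, y) for the number of b-visible points in [1, x] × [1, y]. Sorting the points
-- of [1, x] × [1, y] by the value k of gcd_b, and using gcd_b(n k, m kᵇ) = k · gcd_b(n, m),
-- gives xy = Σ_{k ≤ x} V(⌊x/k⌋, ⌊y/kᵇ⌋). Every visible point has at most four neighbours,
-- so Σ_{r,s ≤ N} Λ(r, s) differs from 4 V(N, N) by at most 4N.
--
-- The identity is inverted without Möbius functions, by a bootstrap. Let Z be the partial
-- sum of ζ(b + 1) up to K. Splitting the identity into k = 1, 2 ≤ k ≤ K and k > K, the
-- terms 2 ≤ k ≤ K carry total weight at most 3/4, the tail at most 1/K, and replacing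
-- ⌊x/k⌋⌊y/kᵇ⌋ by xy/k^{b+1} costs at most K(x + y + 1) ≤ xy/K once x, y ≥ 3K². Hence the
-- relative error θ of Z·V(x, y) ≈ xy shrinks to 3/4 θ + 2/K each time x and y grow by a
-- factor Kᵇ, and after j steps it is at most (3/4)ʲ + 8/K. So V(N, N)/N² → 1/ζ(b + 1) and
-- the mean value of Λ is 4/ζ(b + 1).

module GeneralisedGcd where

  open import Defs
  open import Data.Nat
  open import Data.Nat.Properties
  open import Data.Nat.Divisibility
  open import Data.Nat.GCD using (gcd; gcd[m,n]∣m; gcd[m,n]∣n; gcd[m,n]≢0)
  open import Data.Nat.Coprimality as Coprime using (Coprime; coprime-/gcd; coprime-divisor)
  open import Data.Nat.DivMod using (_/_; m/n*n≡m)
  open import Data.Nat.Tactic.RingSolver using (solve-∀)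
  open import Data.Product using (_×_; _,_; proj₁; proj₂)
  open import Data.Sum using (inj₁)
  open import Relation.Nullary using (¬_; yes; no; does; contradiction)
  open import Data.Bool using (if_then_else_; _∧_)
  open import Function using (_∘_)
  open import Relation.Binary.PropositionalEquality

  ^-distribʳ-* : ∀ m n o → (m * n) ^ o ≡ m ^ o * n ^ o
  ^-distribʳ-* m n zero    = refl
  ^-distribʳ-* m n (suc o) = begin
    m * n * (m * n) ^ o      ≡⟨ cong (m * n *_) (^-distribʳ-* m n o) ⟩
    m * n * (m ^ o * n ^ o)  ≡⟨ lemma m n (m ^ o) (n ^ o) ⟩
    m * m ^ o * (n * n ^ o)  ∎
    where
    open ≡-Reasoning
    lemma : ∀ a c u v → a * c * (u * v) ≡ a * u * (c * v)
    lemma = solve-∀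

  coprime-*ʳ : ∀ {a c e} → Coprime a c → Coprime a e → Coprime a (c * e)
  coprime-*ʳ {a} {c} ac ae {i} (i∣a , i∣ce) = ae (i∣a , coprime-divisor i⊥c i∣ce)
    where
    i⊥c : Coprime i c
    i⊥c (j∣i , j∣c) = ac (∣-trans j∣i i∣a , j∣c)

  coprime-^ʳ : ∀ {a c} n → Coprime a c → Coprime a (c ^ n)
  coprime-^ʳ zero    ac (_ , i∣1) = ∣1⇒≡1 i∣1
  coprime-^ʳ (suc n) ac = coprime-*ʳ ac (coprime-^ʳ n ac)

  coprime-^ : ∀ {a c} n → Coprime a c → Coprime (a ^ n) (c ^ n)
  coprime-^ n ac = coprime-^ʳ n (Coprime.sym (coprime-^ʳ n (Coprime.sym ac)))

  *-coprime-∣ : ∀ {a c d n} .{{_ : NonZero d}} → Coprime a c → a * d ∣ n → c * d ∣ n → a * c * d ∣ n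
  *-coprime-∣ {a} {c} {d} a⊥c ad∣n (divides q refl) =
    subst (_∣ q * (c * d)) (sym (*-assoc a c d)) (*-monoˡ-∣ (c * d) a∣q)
    where
    a∣q : a ∣ q
    a∣q = coprime-divisor a⊥c (subst (a ∣_) (*-comm q c) (*-cancelʳ-∣ d (subst (a * d ∣_) (sym (*-assoc q c d)) ad∣n)))

  BDivisor : ℕ → ℕ → ℕ → ℕ → Set
  BDivisor b r s k = k ∣ r × k ^ b ∣ s

  b-divisor-1 : ∀ b r s → BDivisor b r s 1
  b-divisor-1 b r s = 1∣ r , subst (_∣ s) (sym (^-zeroˡ b)) (1∣ s)

  data GcdbStep (b r s k : ℕ) : Set where
    found : BDivisor b r s (suc k) → gcdbFrom b r s (suc k) ≡ suc k → GcdbStep b r s k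
    skip  : ¬ BDivisor b r s (suc k) → gcdbFrom b r s (suc k) ≡ gcdbFrom b r s k → GcdbStep b r s k

  gcdbStep : ∀ b r s k → GcdbStep b r s k
  gcdbStep b r s k with suc k ∣? r in e₁ | suc k ^ b ∣? s in e₂
  ... | yes k∣r | yes kᵇ∣s = found (k∣r , kᵇ∣s) (cong₂ (λ u v → if does u ∧ does v then suc k else gcdbFrom b r s k) e₁ e₂)
  ... | yes _   | no kᵇ∤s  = skip (kᵇ∤s ∘ proj₂) (cong₂ (λ u v → if does u ∧ does v then suc k else gcdbFrom b r s k) e₁ e₂)
  ... | no k∤r  | _        = skip (k∤r ∘ proj₁) (cong (λ u → if does u ∧ does (suc k ^ b ∣? s) then suc k else gcdbFrom b r s k) e₁)

  gcdbFrom-b-divisor : ∀ b r s k → BDivisor b r s (gcdbFrom b r s k)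
  gcdbFrom-b-divisor b r s zero = b-divisor-1 b r s
  gcdbFrom-b-divisor b r s (suc k) with gcdbStep b r s k
  ... | found dk e rewrite e = dk
  ... | skip _ e   rewrite e = gcdbFrom-b-divisor b r s k

  gcdbFrom-pos : ∀ b r s k → 1 ≤ gcdbFrom b r s k
  gcdbFrom-pos b r s zero = ≤-refl
  gcdbFrom-pos b r s (suc k) with gcdbStep b r s k
  ... | found _ e rewrite e = s≤s z≤n
  ... | skip _ e  rewrite e = gcdbFrom-pos b r s k

  gcdbFrom-greatest : ∀ b r s k {j} → j ≤ k → BDivisor b r s j → j ≤ gcdbFrom b r s k
  gcdbFrom-greatest b r s zero    j≤0 _ = ≤-trans j≤0 z≤n
  gcdbFrom-greatest b r s (suc k) j≤1+k dj with gcdbStep b r s k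
  ... | found _ e rewrite e = j≤1+k
  ... | skip ¬dk e rewrite e = gcdbFrom-greatest b r s k (≤-pred (≤∧≢⇒< j≤1+k λ { refl → ¬dk dj })) dj

  gcdb-b-divisor : ∀ b r s → BDivisor b r s (gcdb b r s)
  gcdb-b-divisor b r s = gcdbFrom-b-divisor b r s r

  gcdb-pos : ∀ b r s → 1 ≤ gcdb b r s
  gcdb-pos b r s = gcdbFrom-pos b r s r

  gcdb-greatest : ∀ b {r} s {j} → 1 ≤ r → BDivisor b r s j → j ≤ gcdb b r s
  gcdb-greatest b {r} s 1≤r dj = gcdbFrom-greatest b r s r (∣⇒≤ {{>-nonZero 1≤r}} (proj₁ dj)) dj

  gcdb≤ : ∀ b {r} s → 1 ≤ r → gcdb b r s ≤ r
  gcdb≤ b {r} s 1≤r = ∣⇒≤ {{>-nonZero 1≤r}} (proj₁ (gcdb-b-divisor b r s))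

  divisor-pos : ∀ {k r} → 1 ≤ r → k ∣ r → 1 ≤ k
  divisor-pos {zero}  1≤r 0∣r = contradiction (0∣⇒≡0 0∣r) (≢-nonZero⁻¹ _ {{>-nonZero 1≤r}})
  divisor-pos {suc k} _   _   = s≤s z≤n

  b-divisor-lcm : ∀ {b r s a c d} .{{_ : NonZero d}} → Coprime a c →
                  BDivisor b r s (a * d) → BDivisor b r s (c * d) → BDivisor b r s (a * c * d)
  b-divisor-lcm {b} {r} {s} {a} {c} {d} a⊥c (ad∣r , [ad]ᵇ∣s) (cd∣r , [cd]ᵇ∣s) =
    *-coprime-∣ a⊥c ad∣r cd∣r ,
    subst (_∣ s) (sym [acd]ᵇ) (*-coprime-∣ {{m^n≢0 d b}} (coprime-^ b a⊥c)
      (subst (_∣ s) (^-distribʳ-* a d b) [ad]ᵇ∣s) (subst (_∣ s) (^-distribʳ-* c d b) [cd]ᵇ∣s))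
    where
    [acd]ᵇ : (a * c * d) ^ b ≡ a ^ b * c ^ b * d ^ b
    [acd]ᵇ = trans (^-distribʳ-* (a * c) d b) (cong (_* d ^ b) (^-distribʳ-* a c b))

  -- The lcm of k and gcd_b(r, s) is again a b-divisor, so by maximality gcd(k, gcd_b(r, s)) = k.
  b-divisor∣gcdb : ∀ b {r} s {k} → 1 ≤ r → BDivisor b r s k → k ∣ gcdb b r s
  b-divisor∣gcdb b {r} s {k} 1≤r dk@(k∣r , _) = subst (_∣ g) (sym k≡d) (gcd[m,n]∣n k g)
    where
    g d : ℕ
    g = gcdb b r s
    d = gcd k g
    1≤k : 1 ≤ k
    1≤k = divisor-pos 1≤r k∣r
    instance
      d≢0 : NonZero d
      d≢0 = ≢-nonZero (gcd[m,n]≢0 k g (inj₁ (≢-nonZero⁻¹ k {{>-nonZero 1≤k}})))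
    k′ g′ : ℕ
    k′ = k / d
    g′ = g / d
    k≡k′d : k ≡ k′ * d
    k≡k′d = sym (m/n*n≡m (gcd[m,n]∣m k g))
    g≡g′d : g ≡ g′ * d
    g≡g′d = sym (m/n*n≡m (gcd[m,n]∣n k g))
    lcm : BDivisor b r s (k′ * g′ * d)
    lcm = b-divisor-lcm {b} (coprime-/gcd k g)
            (subst (BDivisor b r s) k≡k′d dk) (subst (BDivisor b r s) g≡g′d (gcdb-b-divisor b r s))
    k′g≤1g : k′ * g ≤ 1 * g
    k′g≤1g = begin
      k′ * g          ≡⟨ cong (k′ *_) g≡g′d ⟩
      k′ * (g′ * d)   ≡⟨ *-assoc k′ g′ d ⟨
      k′ * g′ * d     ≤⟨ gcdb-greatest b s 1≤r lcm ⟩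
      g               ≡⟨ *-identityˡ g ⟨
      1 * g           ∎
      where open ≤-Reasoning
    k′≡1 : k′ ≡ 1
    k′≡1 = ≤-antisym (*-cancelʳ-≤ k′ 1 g {{>-nonZero (gcdb-pos b r s)}} k′g≤1g)
                     (divisor-pos 1≤k (divides d (trans k≡k′d (*-comm k′ d))))
    k≡d : k ≡ d
    k≡d = trans k≡k′d (trans (cong (_* d) k′≡1) (*-identityˡ d))

  gcdb-* : ∀ b {n} m {k} → 1 ≤ n → 1 ≤ k → gcdb b (n * k) (m * k ^ b) ≡ k * gcdb b n m
  gcdb-* b {n} m {k} 1≤n 1≤k = ≤-antisym G≤kg (gcdb-greatest b (m * k ^ b) 1≤nk kg-divisor)
    where
    instance
      k≢0 : NonZero k
      k≢0 = >-nonZero 1≤k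
    g G : ℕ
    g = gcdb b n m
    G = gcdb b (n * k) (m * k ^ b)
    1≤nk : 1 ≤ n * k
    1≤nk = *-mono-≤ 1≤n 1≤k
    kg-divisor : BDivisor b (n * k) (m * k ^ b) (k * g)
    kg-divisor = subst (k * g ∣_) (*-comm k n) (*-monoʳ-∣ k (proj₁ (gcdb-b-divisor b n m))) ,
                 subst₂ _∣_ (sym (^-distribʳ-* k g b)) (*-comm (k ^ b) m) (*-monoʳ-∣ (k ^ b) (proj₂ (gcdb-b-divisor b n m)))
    k∣G : k ∣ G
    k∣G = b-divisor∣gcdb b (m * k ^ b) 1≤nk (divides n refl , divides m refl)
    t : ℕ
    t = quotient k∣G
    t-divisor : BDivisor b n m t
    t-divisor = *-cancelʳ-∣ k (subst (_∣ n * k) (_∣_.equality k∣G) (proj₁ (gcdb-b-divisor b (n * k) (m * k ^ b)))) ,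
                *-cancelʳ-∣ (k ^ b) {{m^n≢0 k b}}
                  (subst (_∣ m * k ^ b) (trans (cong (_^ b) (_∣_.equality k∣G)) (^-distribʳ-* t k b))
                     (proj₂ (gcdb-b-divisor b (n * k) (m * k ^ b))))
    G≤kg : G ≤ k * g
    G≤kg = begin
      G      ≡⟨ _∣_.equality k∣G ⟩
      t * k  ≤⟨ *-monoˡ-≤ k (gcdb-greatest b m 1≤n t-divisor) ⟩
      g * k  ≡⟨ *-comm g k ⟩
      k * g  ∎
      where open ≤-Reasoning

module NatSums where

  open import Defs
  open import Data.Nat
  open import Data.Nat.Properties
  open import Data.Nat.Tactic.RingSolver using (solve-∀)
  open import Data.Bool using (true; false)
  open import Data.Sum using (inj₁; inj₂)
  open import Relation.Nullary using (does; contradiction)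
  open import Relation.Nullary.Decidable using (dec-true; dec-false)
  open import Relation.Binary.PropositionalEquality

  sum1-cong : ∀ n {f g : ℕ → ℕ} → (∀ i → 1 ≤ i → i ≤ n → f i ≡ g i) → sum1 n f ≡ sum1 n g
  sum1-cong zero    f≗g = refl
  sum1-cong (suc n) f≗g = cong₂ _+_ (sum1-cong n λ i 1≤i i≤n → f≗g i 1≤i (m≤n⇒m≤1+n i≤n)) (f≗g (suc n) (s≤s z≤n) ≤-refl)

  sum1-mono-≤ : ∀ n {f g : ℕ → ℕ} → (∀ i → 1 ≤ i → i ≤ n → f i ≤ g i) → sum1 n f ≤ sum1 n g
  sum1-mono-≤ zero    f≤g = ≤-refl
  sum1-mono-≤ (suc n) f≤g = +-mono-≤ (sum1-mono-≤ n λ i 1≤i i≤n → f≤g i 1≤i (m≤n⇒m≤1+n i≤n)) (f≤g (suc n) (s≤s z≤n) ≤-refl)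

  sum1-const : ∀ n c → sum1 n (λ _ → c) ≡ n * c
  sum1-const zero    c = refl
  sum1-const (suc n) c = trans (cong (_+ c) (sum1-const n c)) (+-comm (n * c) c)

  sum1-zero : ∀ n {f : ℕ → ℕ} → (∀ i → 1 ≤ i → i ≤ n → f i ≡ 0) → sum1 n f ≡ 0
  sum1-zero n f≗0 = trans (sum1-cong n f≗0) (trans (sum1-const n 0) (*-zeroʳ n))

  sum1-bounded : ∀ n {f : ℕ → ℕ} {c} → (∀ i → f i ≤ c) → sum1 n f ≤ n * c
  sum1-bounded n {c = c} f≤c = ≤-trans (sum1-mono-≤ n λ i _ _ → f≤c i) (≤-reflexive (sum1-const n c))

  indicator≤1 : ∀ x → indicator x ≤ 1
  indicator≤1 true  = ≤-refl
  indicator≤1 false = z≤n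

  sum1-distrib-+ : ∀ n (f g : ℕ → ℕ) → sum1 n (λ i → f i + g i) ≡ sum1 n f + sum1 n g
  sum1-distrib-+ zero    f g = refl
  sum1-distrib-+ (suc n) f g = trans (cong (_+ (f (suc n) + g (suc n))) (sum1-distrib-+ n f g))
                                     (lemma (sum1 n f) (sum1 n g) (f (suc n)) (g (suc n)))
    where
    lemma : ∀ a b c d → a + b + (c + d) ≡ a + c + (b + d)
    lemma = solve-∀

  sum1-comm : ∀ n m (f : ℕ → ℕ → ℕ) → sum1 n (λ i → sum1 m (f i)) ≡ sum1 m (λ j → sum1 n (λ i → f i j))
  sum1-comm zero    m f = sym (sum1-zero m λ _ _ _ → refl)
  sum1-comm (suc n) m f = trans (cong (_+ sum1 m (f (suc n))) (sum1-comm n m f))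
                                (sym (sum1-distrib-+ m (λ j → sum1 n (λ i → f i j)) (f (suc n))))

  sum1-indicator-≡ : ∀ n {c} → 1 ≤ c → c ≤ n → sum1 n (λ k → indicator (does (c ≟ k))) ≡ 1
  sum1-indicator-≡ zero    1≤c c≤0 = contradiction c≤0 (<⇒≱ 1≤c)
  sum1-indicator-≡ (suc n) {c} 1≤c c≤1+n with m≤n⇒m<n∨m≡n c≤1+n
  ... | inj₁ c<1+n rewrite dec-false (c ≟ suc n) (<⇒≢ c<1+n) = cong (_+ 0) (sum1-indicator-≡ n 1≤c (≤-pred c<1+n))
  ... | inj₂ refl  rewrite dec-true (c ≟ c) refl = cong (_+ 1) (sum1-zero n λ k _ k≤n →
          cong indicator (dec-false (suc n ≟ k) λ { refl → <-irrefl refl k≤n }))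

module VisibleCount where

  open import Defs
  open GeneralisedGcd
  open NatSums
  open import Data.Nat
  open import Data.Nat.Properties
  open import Data.Nat.Divisibility
  open import Data.Nat.DivMod using (_/_; _%_; m≡m%n+[m/n]*n; m%n<n; +-distrib-/-∣ˡ; m*n/n≡m; m<n⇒m/n≡0; 0/n≡0)
  open import Data.Bool using (if_then_else_)
  open import Data.Product using (_,_; proj₁; proj₂)
  open import Data.Sum using (inj₁; inj₂)
  open import Relation.Nullary using (¬_; Dec; yes; no; does)
  open import Relation.Nullary.Decidable using (dec-true; dec-false)
  open import Relation.Binary.PropositionalEquality

  -- The junk value ⌊ x / 0 ⌋ = 0 spares the NonZero instance.
  ⌊_/_⌋ : ℕ → ℕ → ℕ
  ⌊ x / zero  ⌋ = 0
  ⌊ x / suc k ⌋ = x / suc k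

  ⌊n*k/k⌋≡n : ∀ n {k} → 1 ≤ k → ⌊ n * k / k ⌋ ≡ n
  ⌊n*k/k⌋≡n n {suc k} _ = m*n/n≡m n (suc k)

  [q*k+r]/k≡q : ∀ q {k r} .{{_ : NonZero k}} → r < k → (q * k + r) / k ≡ q
  [q*k+r]/k≡q q {k} {r} r<k = begin
    (q * k + r) / k      ≡⟨ +-distrib-/-∣ˡ r (divides q refl) ⟩
    q * k / k + r / k    ≡⟨ cong₂ _+_ (m*n/n≡m q k) (m<n⇒m/n≡0 r<k) ⟩
    q + 0                ≡⟨ +-identityʳ q ⟩
    q                    ∎
    where open ≡-Reasoning

  k∤q*k+r : ∀ q {k r} → 0 < r → r < k → ¬ k ∣ q * k + r
  k∤q*k+r q {k} 0<r r<k k∣qk+r =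
    <⇒≱ r<k (∣⇒≤ {{>-nonZero 0<r}} (∣m+n∣m⇒∣n k∣qk+r (divides q refl)))

  data ⌊suc/⌋-View (x k : ℕ) : Set where
    divisible   : k ∣ suc x   → ⌊ suc x / k ⌋ ≡ suc ⌊ x / k ⌋ → ⌊suc/⌋-View x k
    indivisible : ¬ k ∣ suc x → ⌊ suc x / k ⌋ ≡ ⌊ x / k ⌋     → ⌊suc/⌋-View x k

  ⌊suc/⌋-view : ∀ x k → ⌊suc/⌋-View x (suc k)
  ⌊suc/⌋-view x k with m≤n⇒m<n∨m≡n (m%n<n x (suc k))
  ... | inj₁ 1+r<k = indivisible (subst (λ z → ¬ suc k ∣ z) (sym 1+x≡) (k∤q*k+r q (s≤s z≤n) 1+r<k))
                                 (trans (cong (_/ suc k) 1+x≡) ([q*k+r]/k≡q q 1+r<k))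
    where
    q r : ℕ
    q = x / suc k
    r = x % suc k
    1+x≡ : suc x ≡ q * suc k + suc r
    1+x≡ = trans (cong suc (trans (m≡m%n+[m/n]*n x (suc k)) (+-comm r (q * suc k)))) (sym (+-suc (q * suc k) r))
  ... | inj₂ 1+r≡k = divisible (divides (suc q) 1+x≡) (trans (cong (_/ suc k) 1+x≡) (m*n/n≡m (suc q) (suc k)))
    where
    q : ℕ
    q = x / suc k
    1+x≡ : suc x ≡ suc q * suc k
    1+x≡ = trans (cong suc (m≡m%n+[m/n]*n x (suc k))) (cong (_+ q * suc k) 1+r≡k)

  onMultiples : ℕ → (ℕ → ℕ) → ℕ → ℕ
  onMultiples k h n = if does (k ∣? n) then h ⌊ n / k ⌋ else 0

  onMultiples-∣ : ∀ k h {n} → k ∣ n → onMultiples k h n ≡ h ⌊ n / k ⌋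
  onMultiples-∣ k h {n} k∣n rewrite dec-true (k ∣? n) k∣n = refl

  onMultiples-∤ : ∀ k h {n} → ¬ k ∣ n → onMultiples k h n ≡ 0
  onMultiples-∤ k h {n} k∤n rewrite dec-false (k ∣? n) k∤n = refl

  sum1-onMultiples : ∀ x {k} h → 1 ≤ k → sum1 x (onMultiples k h) ≡ sum1 ⌊ x / k ⌋ h
  sum1-onMultiples zero    {suc k} h _ = cong (λ z → sum1 z h) (sym (0/n≡0 (suc k)))
  sum1-onMultiples (suc x) {suc k} h 1≤k with ⌊suc/⌋-view x k
  ... | divisible k∣1+x e = begin
    sum1 x (onMultiples (suc k) h) + onMultiples (suc k) h (suc x)
      ≡⟨ cong₂ _+_ (sum1-onMultiples x h 1≤k) (onMultiples-∣ (suc k) h k∣1+x) ⟩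
    sum1 ⌊ x / suc k ⌋ h + h ⌊ suc x / suc k ⌋
      ≡⟨ cong (λ z → sum1 ⌊ x / suc k ⌋ h + h z) e ⟩
    sum1 (suc ⌊ x / suc k ⌋) h
      ≡⟨ cong (λ z → sum1 z h) e ⟨
    sum1 ⌊ suc x / suc k ⌋ h ∎
    where open ≡-Reasoning
  ... | indivisible k∤1+x e = begin
    sum1 x (onMultiples (suc k) h) + onMultiples (suc k) h (suc x)
      ≡⟨ cong₂ _+_ (sum1-onMultiples x h 1≤k) (onMultiples-∤ (suc k) h k∤1+x) ⟩
    sum1 ⌊ x / suc k ⌋ h + 0
      ≡⟨ +-identityʳ _ ⟩
    sum1 ⌊ x / suc k ⌋ h
      ≡⟨ cong (λ z → sum1 z h) e ⟨
    sum1 ⌊ suc x / suc k ⌋ h ∎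
    where open ≡-Reasoning

  sum1-onMultiples-comm : ∀ y k n (H : ℕ → ℕ → ℕ) →
    sum1 y (λ m → onMultiples k (H m) n) ≡ onMultiples k (λ n′ → sum1 y (λ m → H m n′)) n
  sum1-onMultiples-comm y k n H = byCases (k ∣? n)
    where
    byCases : Dec (k ∣ n) → sum1 y (λ m → onMultiples k (H m) n) ≡ onMultiples k (λ n′ → sum1 y (λ m → H m n′)) n
    byCases (yes k∣n) = trans (sum1-cong y λ m _ _ → onMultiples-∣ k (H m) k∣n)
                              (sym (onMultiples-∣ k (λ n′ → sum1 y (λ m → H m n′)) k∣n))
    byCases (no k∤n)  = trans (sum1-zero y λ m _ _ → onMultiples-∤ k (H m) k∤n)
                              (sym (onMultiples-∤ k (λ n′ → sum1 y (λ m → H m n′)) k∤n))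

  𝟙visible : ℕ → ℕ → ℕ → ℕ
  𝟙visible b n m = indicator (visible? b n m)

  countVisible : ℕ → ℕ → ℕ → ℕ
  countVisible b x y = sum1 x (λ n → sum1 y (𝟙visible b n))

  countVisible≤ : ∀ b x y → countVisible b x y ≤ x * y
  countVisible≤ b x y = sum1-bounded x λ n → ≤-trans (sum1-bounded y λ m → indicator≤1 (visible? b n m)) (≤-reflexive (*-identityʳ y))

  does-*≟ : ∀ {k} g → 1 ≤ k → does (k * g ≟ k) ≡ does (g ≟ 1)
  does-*≟ {k} g 1≤k = byCases (g ≟ 1)
    where
    byCases : (g≟1 : Dec (g ≡ 1)) → does (k * g ≟ k) ≡ does g≟1
    byCases (yes refl) = dec-true (k * 1 ≟ k) (*-identityʳ k)
    byCases (no g≢1)   = dec-false (k * g ≟ k) λ kg≡k →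
      g≢1 (*-cancelˡ-≡ g 1 k {{>-nonZero 1≤k}} (trans kg≡k (sym (*-identityʳ k))))

  -- gcd_b(n, m) = k exactly when n = n′k and m = m′kᵇ with (n′, m′) b-visible.
  indicator-gcdb≡ : ∀ b {n} m {k} → 1 ≤ n → 1 ≤ k →
    indicator (does (gcdb b n m ≟ k)) ≡ onMultiples k (λ n′ → onMultiples (k ^ b) (𝟙visible b n′) m) n
  indicator-gcdb≡ b {n} m {k} 1≤n 1≤k = byCases (k ∣? n) (k ^ b ∣? m)
    where
    open ≡-Reasoning
    visibleAbove : ℕ → ℕ
    visibleAbove n′ = onMultiples (k ^ b) (𝟙visible b n′) m
    byCases : Dec (k ∣ n) → Dec (k ^ b ∣ m) → indicator (does (gcdb b n m ≟ k)) ≡ onMultiples k visibleAbove n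
    byCases (no k∤n) _ = begin
      indicator (does (gcdb b n m ≟ k)) ≡⟨ cong indicator (dec-false (gcdb b n m ≟ k) λ { refl → k∤n (proj₁ (gcdb-b-divisor b n m)) }) ⟩
      0                                 ≡⟨ onMultiples-∤ k visibleAbove k∤n ⟨
      onMultiples k visibleAbove n      ∎
    byCases (yes k∣n) (no kᵇ∤m) = begin
      indicator (does (gcdb b n m ≟ k)) ≡⟨ cong indicator (dec-false (gcdb b n m ≟ k) λ { refl → kᵇ∤m (proj₂ (gcdb-b-divisor b n m)) }) ⟩
      0                                 ≡⟨ onMultiples-∤ (k ^ b) (𝟙visible b ⌊ n / k ⌋) kᵇ∤m ⟨
      visibleAbove ⌊ n / k ⌋            ≡⟨ onMultiples-∣ k visibleAbove k∣n ⟨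
      onMultiples k visibleAbove n      ∎
    byCases (yes k∣n@(divides n′ refl)) (yes kᵇ∣m@(divides m′ refl)) = begin
      indicator (does (gcdb b (n′ * k) (m′ * k ^ b) ≟ k))
        ≡⟨ cong (λ g → indicator (does (g ≟ k))) (gcdb-* b m′ 1≤n′ 1≤k) ⟩
      indicator (does (k * gcdb b n′ m′ ≟ k))
        ≡⟨ cong indicator (does-*≟ (gcdb b n′ m′) 1≤k) ⟩
      𝟙visible b n′ m′
        ≡⟨ cong₂ (𝟙visible b) (⌊n*k/k⌋≡n n′ 1≤k) (⌊n*k/k⌋≡n m′ (m^n>0 k {{>-nonZero 1≤k}} b)) ⟨
      𝟙visible b ⌊ n′ * k / k ⌋ ⌊ m′ * k ^ b / k ^ b ⌋
        ≡⟨ trans (onMultiples-∣ k visibleAbove k∣n) (onMultiples-∣ (k ^ b) (𝟙visible b ⌊ n′ * k / k ⌋) kᵇ∣m) ⟨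
      onMultiples k visibleAbove (n′ * k) ∎
      where
      1≤n′ : 1 ≤ n′
      1≤n′ = divisor-pos 1≤n (divides k (*-comm n′ k))

  x*y≡sum-countVisible : ∀ b x y → x * y ≡ sum1 x (λ k → countVisible b ⌊ x / k ⌋ ⌊ y / k ^ b ⌋)
  x*y≡sum-countVisible b x y = begin
    x * y                                                 ≡⟨ sum1-const x y ⟨
    sum1 x (λ n → y)                                       ≡⟨ sum1-cong x (λ n 1≤n n≤x → trans (sym (*-identityʳ y)) (sym (sum1-const y 1))) ⟩
    sum1 x (λ n → sum1 y (λ m → 1))                        ≡⟨ sum1-cong x (λ n 1≤n n≤x → sum1-cong y λ m _ _ →
                                                                sym (sum1-indicator-≡ x (gcdb-pos b n m) (≤-trans (gcdb≤ b m 1≤n) n≤x))) ⟩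
    sum1 x (λ n → sum1 y (λ m → sum1 x (𝟙gcdb≡ n m)))      ≡⟨ sum1-cong x (λ n _ _ → sum1-comm y x (𝟙gcdb≡ n)) ⟩
    sum1 x (λ n → sum1 x (λ k → sum1 y (λ m → 𝟙gcdb≡ n m k))) ≡⟨ sum1-comm x x (λ n k → sum1 y (λ m → 𝟙gcdb≡ n m k)) ⟩
    sum1 x (λ k → sum1 x (λ n → sum1 y (λ m → 𝟙gcdb≡ n m k))) ≡⟨ sum1-cong x (λ k 1≤k _ → countAt k 1≤k) ⟩
    sum1 x (λ k → countVisible b ⌊ x / k ⌋ ⌊ y / k ^ b ⌋)  ∎
    where
    open ≡-Reasoning
    𝟙gcdb≡ : ℕ → ℕ → ℕ → ℕ
    𝟙gcdb≡ n m k = indicator (does (gcdb b n m ≟ k))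
    countAt : ∀ k → 1 ≤ k → sum1 x (λ n → sum1 y (λ m → 𝟙gcdb≡ n m k)) ≡ countVisible b ⌊ x / k ⌋ ⌊ y / k ^ b ⌋
    countAt k 1≤k = begin
      sum1 x (λ n → sum1 y (λ m → 𝟙gcdb≡ n m k))
        ≡⟨ sum1-cong x (λ n 1≤n _ → sum1-cong y λ m _ _ → indicator-gcdb≡ b m 1≤n 1≤k) ⟩
      sum1 x (λ n → sum1 y (λ m → onMultiples k (λ n′ → onMultiples (k ^ b) (𝟙visible b n′) m) n))
        ≡⟨ sum1-cong x (λ n _ _ → sum1-onMultiples-comm y k n λ m n′ → onMultiples (k ^ b) (𝟙visible b n′) m) ⟩
      sum1 x (onMultiples k (λ n′ → sum1 y (onMultiples (k ^ b) (𝟙visible b n′))))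
        ≡⟨ sum1-onMultiples x _ 1≤k ⟩
      sum1 ⌊ x / k ⌋ (λ n′ → sum1 y (onMultiples (k ^ b) (𝟙visible b n′)))
        ≡⟨ sum1-cong ⌊ x / k ⌋ (λ n′ _ _ → sum1-onMultiples y (𝟙visible b n′) (m^n>0 k {{>-nonZero 1≤k}} b)) ⟩
      countVisible b ⌊ x / k ⌋ ⌊ y / k ^ b ⌋ ∎

module NeighbourSum where

  open import Defs
  open NatSums
  open VisibleCount
  open import Data.Nat
  open import Data.Nat.Properties
  open import Data.Nat.Tactic.RingSolver using (solve-∀)
  open import Data.Bool using (_∧_)
  open import Data.Bool.Properties using (∧-zeroʳ; ∧-identityʳ)
  open import Data.Product using (_×_; _,_)
  open import Relation.Nullary using (does)
  open import Relation.Nullary.Decidable using (dec-false)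
  open import Relation.Binary.PropositionalEquality

  -- f (c ∸ 1), except 0 when c ∸ 1 = 0: the neighbour below c has to stay in ℕ⁺.
  atPred : (ℕ → ℕ) → ℕ → ℕ
  atPred f zero                = 0
  atPred f (suc zero)          = 0
  atPred f (suc (suc c))       = f (suc c)

  atPred-cong : ∀ c {f g : ℕ → ℕ} → (∀ m → suc (suc m) ≡ c → f (suc m) ≡ g (suc m)) → atPred f c ≡ atPred g c
  atPred-cong zero          f≗g = refl
  atPred-cong (suc zero)    f≗g = refl
  atPred-cong (suc (suc c)) f≗g = f≗g c refl

  atPred-≤ : ∀ (f : ℕ → ℕ) c {e} → (∀ i → f i ≤ e) → atPred f c ≤ e
  atPred-≤ f zero          f≤e = z≤n
  atPred-≤ f (suc zero)    f≤e = z≤n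
  atPred-≤ f (suc (suc c)) f≤e = f≤e (suc c)

  sum1-atPred : ∀ N r (f : ℕ → ℕ → ℕ) → sum1 N (λ s → atPred (λ n → f n s) r) ≡ atPred (λ n → sum1 N (f n)) r
  sum1-atPred N zero          f = sum1-zero N λ _ _ _ → refl
  sum1-atPred N (suc zero)    f = sum1-zero N λ _ _ _ → refl
  sum1-atPred N (suc (suc r)) f = refl

  sum1-atPred+atPred : ∀ N (f : ℕ → ℕ) → sum1 N (atPred f) + atPred f (suc N) ≡ sum1 N f
  sum1-atPred+atPred zero    f = refl
  sum1-atPred+atPred (suc N) f = cong (_+ f (suc N)) (sum1-atPred+atPred N f)

  sum1-shift : ∀ N (f : ℕ → ℕ) → sum1 N (λ s → f (suc s)) + f 1 ≡ sum1 N f + f (suc N)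
  sum1-shift zero    f = refl
  sum1-shift (suc N) f = begin
    sum1 N (λ s → f (suc s)) + f (suc (suc N)) + f 1  ≡⟨ lemma (sum1 N (λ s → f (suc s))) (f (suc (suc N))) (f 1) ⟩
    sum1 N (λ s → f (suc s)) + f 1 + f (suc (suc N))  ≡⟨ cong (_+ f (suc (suc N))) (sum1-shift N f) ⟩
    sum1 N f + f (suc N) + f (suc (suc N))            ∎
    where
    open ≡-Reasoning
    lemma : ∀ a b c → a + b + c ≡ a + c + b
    lemma = solve-∀

  sum1-last3 : ∀ c (f : ℕ → ℕ) → 1 ≤ c → (∀ m → 2 + m ≤ c → f m ≡ 0) → sum1 (suc c) f ≡ atPred f c + f c + f (suc c)
  sum1-last3 (suc zero)    f _ _    = refl
  sum1-last3 (suc (suc c)) f _ f≗0 = cong (λ z → z + f (suc c) + f (suc (suc c)) + f (suc (suc (suc c)))) (sum1-zero c λ m _ m≤c → f≗0 m (s≤s (s≤s m≤c)))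

  2+m≤n⇒2≤∣m-n∣ : ∀ m n → 2 + m ≤ n → 2 ≤ ∣ m - n ∣
  2+m≤n⇒2≤∣m-n∣ zero    n       2≤n            = 2≤n
  2+m≤n⇒2≤∣m-n∣ (suc m) (suc n) (s≤s 2+m≤n) = 2+m≤n⇒2≤∣m-n∣ m n 2+m≤n

  ∣1+n-n∣≡1 : ∀ n → ∣ suc n - n ∣ ≡ 1
  ∣1+n-n∣≡1 zero    = refl
  ∣1+n-n∣≡1 (suc n) = ∣1+n-n∣≡1 n

  ∣n-1+n∣≡1 : ∀ n → ∣ n - suc n ∣ ≡ 1
  ∣n-1+n∣≡1 zero    = refl
  ∣n-1+n∣≡1 (suc n) = ∣n-1+n∣≡1 n

  module Neighbours (b r s : ℕ) where

    neighbour : ℕ → ℕ → ℕ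
    neighbour n m = indicator (visible? b n m ∧ does ((∣ n - r ∣ + ∣ m - s ∣) ≟ 1))

    neighbour-at-1 : ∀ n m → ∣ n - r ∣ + ∣ m - s ∣ ≡ 1 → neighbour n m ≡ 𝟙visible b n m
    neighbour-at-1 n m d≡1 rewrite d≡1 = cong indicator (∧-identityʳ (visible? b n m))

    neighbour-off-1 : ∀ n m t → ∣ n - r ∣ + ∣ m - s ∣ ≡ t → t ≢ 1 → neighbour n m ≡ 0
    neighbour-off-1 n m t d≡t t≢1 rewrite d≡t | dec-false (t ≟ 1) t≢1 = cong indicator (∧-zeroʳ (visible? b n m))

    neighbour-far : ∀ n m → 2 ≤ ∣ n - r ∣ + ∣ m - s ∣ → neighbour n m ≡ 0
    neighbour-far n m 2≤d = neighbour-off-1 n m _ refl λ d≡1 → <⇒≱ (s≤s (s≤s z≤n)) (≤-trans 2≤d (≤-reflexive d≡1))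

    column : ℕ → ℕ
    column n = sum1 (suc s) (neighbour n)

    column-far : ∀ n → 2 + n ≤ r → column n ≡ 0
    column-far n 2+n≤r = sum1-zero (suc s) λ m _ _ → neighbour-far n m (≤-trans (2+m≤n⇒2≤∣m-n∣ n r 2+n≤r) (m≤m+n _ _))

    module _ (1≤s : 1 ≤ s) where

      column-centre : column r ≡ atPred (𝟙visible b r) s + 𝟙visible b r (suc s)
      column-centre = begin
        column r
          ≡⟨ sum1-last3 s (neighbour r) 1≤s (λ m 2+m≤s → neighbour-far r m (≤-trans (2+m≤n⇒2≤∣m-n∣ m s 2+m≤s) (m≤n+m _ _))) ⟩
        atPred (neighbour r) s + neighbour r s + neighbour r (suc s)
          ≡⟨ cong₂ _+_ (cong₂ _+_ below centre) above ⟩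
        atPred (𝟙visible b r) s + 0 + 𝟙visible b r (suc s)
          ≡⟨ cong (_+ 𝟙visible b r (suc s)) (+-identityʳ _) ⟩
        atPred (𝟙visible b r) s + 𝟙visible b r (suc s) ∎
        where
        open ≡-Reasoning
        below : atPred (neighbour r) s ≡ atPred (𝟙visible b r) s
        below = atPred-cong s λ m 2+m≡s → neighbour-at-1 r (suc m) (cong₂ _+_ (∣n-n∣≡0 r) (subst (λ z → ∣ suc m - z ∣ ≡ 1) 2+m≡s (∣n-1+n∣≡1 (suc m))))
        centre : neighbour r s ≡ 0
        centre = neighbour-off-1 r s 0 (cong₂ _+_ (∣n-n∣≡0 r) (∣n-n∣≡0 s)) λ ()
        above : neighbour r (suc s) ≡ 𝟙visible b r (suc s)
        above = neighbour-at-1 r (suc s) (cong₂ _+_ (∣n-n∣≡0 r) (∣1+n-n∣≡1 s))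

      column-side : ∀ n → ∣ n - r ∣ ≡ 1 → column n ≡ 𝟙visible b n s
      column-side n ∣n-r∣≡1 = begin
        column n
          ≡⟨ sum1-last3 s (neighbour n) 1≤s (λ m 2+m≤s → neighbour-far n m (≤-trans (2+m≤n⇒2≤∣m-n∣ m s 2+m≤s) (m≤n+m _ _))) ⟩
        atPred (neighbour n) s + neighbour n s + neighbour n (suc s)
          ≡⟨ cong₂ _+_ (cong₂ _+_ below centre) above ⟩
        0 + 𝟙visible b n s + 0
          ≡⟨ +-identityʳ _ ⟩
        𝟙visible b n s ∎
        where
        open ≡-Reasoning
        below : atPred (neighbour n) s ≡ 0
        below = trans (atPred-cong s {g = λ _ → 0} λ m 2+m≡s →
                        neighbour-off-1 n (suc m) 2 (cong₂ _+_ ∣n-r∣≡1 (subst (λ z → ∣ suc m - z ∣ ≡ 1) 2+m≡s (∣n-1+n∣≡1 (suc m)))) λ ())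
                      (n≤0⇒n≡0 (atPred-≤ (λ _ → 0) s λ _ → z≤n))
        centre : neighbour n s ≡ 𝟙visible b n s
        centre = neighbour-at-1 n s (cong₂ _+_ ∣n-r∣≡1 (∣n-n∣≡0 s))
        above : neighbour n (suc s) ≡ 0
        above = neighbour-off-1 n (suc s) 2 (cong₂ _+_ ∣n-r∣≡1 (∣1+n-n∣≡1 s)) λ ()

      Λ≡ : 1 ≤ r → Λ b r s ≡ atPred (λ n → 𝟙visible b n s) r + (atPred (𝟙visible b r) s + 𝟙visible b r (suc s)) + 𝟙visible b (suc r) s
      Λ≡ 1≤r = trans (sum1-last3 r column 1≤r column-far)
                     (cong₂ _+_ (cong₂ _+_ left column-centre) (column-side (suc r) (∣1+n-n∣≡1 r)))
        where
        left : atPred column r ≡ atPred (λ n → 𝟙visible b n s) r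
        left = atPred-cong r λ m 2+m≡r → column-side (suc m) (subst (λ z → ∣ suc m - z ∣ ≡ 1) 2+m≡r (∣n-1+n∣≡1 (suc m)))

  -- ∣ a - c ∣ ≤ e, stated without subtraction.
  Within : ℕ → ℕ → ℕ → Set
  Within e a c = a ≤ c + e × c ≤ a + e

  within-≡ : ∀ {a c u v e} → a + u ≡ c + v → u ≤ e → v ≤ e → Within e a c
  within-≡ {a} {c} a+u≡c+v u≤e v≤e =
    ≤-trans (m≤m+n a _) (≤-trans (≤-reflexive a+u≡c+v) (+-monoʳ-≤ c v≤e)) ,
    ≤-trans (m≤m+n c _) (≤-trans (≤-reflexive (sym a+u≡c+v)) (+-monoʳ-≤ a u≤e))

  within-+ : ∀ {e e′ a a′ c c′} → Within e a c → Within e′ a′ c′ → Within (e + e′) (a + a′) (c + c′)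
  within-+ {e} {e′} {a} {a′} {c} {c′} (a≤ , c≤) (a′≤ , c′≤) =
    ≤-trans (+-mono-≤ a≤ a′≤) (≤-reflexive (lemma c e c′ e′)) ,
    ≤-trans (+-mono-≤ c≤ c′≤) (≤-reflexive (lemma a e a′ e′))
    where
    lemma : ∀ x y z w → x + y + (z + w) ≡ x + z + (y + w)
    lemma = solve-∀

  Λ-sum-within : ∀ b N → Within (4 * N) (SumΛ b N) (4 * countVisible b N N)
  Λ-sum-within b N = subst₂ (Within (4 * N)) (sym SumΛ≡) (lemma V)
                       (subst (λ e → Within e (leftSum + (belowSum + aboveSum) + rightSum) (V + (V + V) + V)) (lemma N) (within-+ (within-+ left (within-+ below above)) right))
    where
    V = countVisible b N N
    v : ℕ → ℕ → ℕ
    v = 𝟙visible b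
    row : ℕ → ℕ
    row n = sum1 N (v n)
    v≤1 : ∀ n m → v n m ≤ 1
    v≤1 n m = indicator≤1 (visible? b n m)
    col≤N : ∀ {f : ℕ → ℕ} → (∀ r → f r ≤ 1) → sum1 N f ≤ N
    col≤N f≤1 = ≤-trans (sum1-bounded N f≤1) (≤-reflexive (*-identityʳ N))
    row≤N : ∀ n → row n ≤ N
    row≤N n = col≤N (v≤1 n)

    leftSum belowSum aboveSum rightSum : ℕ
    leftSum  = sum1 N (λ r → sum1 N (λ s → atPred (λ n → v n s) r))
    belowSum = sum1 N (λ r → sum1 N (λ s → atPred (v r) s))
    aboveSum = sum1 N (λ r → sum1 N (λ s → v r (suc s)))
    rightSum = sum1 N (λ r → sum1 N (λ s → v (suc r) s))

    sum1-distrib-+⁴ : ∀ (f g h k : ℕ → ℕ) → sum1 N (λ i → f i + (g i + h i) + k i) ≡ sum1 N f + (sum1 N g + sum1 N h) + sum1 N k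
    sum1-distrib-+⁴ f g h k = trans (sum1-distrib-+ N _ k) (cong (_+ sum1 N k)
                                (trans (sum1-distrib-+ N f _) (cong (sum1 N f +_) (sum1-distrib-+ N g h))))

    SumΛ≡ : SumΛ b N ≡ leftSum + (belowSum + aboveSum) + rightSum
    SumΛ≡ = trans (sum1-cong N λ r 1≤r _ → trans (sum1-cong N λ s 1≤s _ → Neighbours.Λ≡ b r s 1≤s 1≤r) (sum1-distrib-+⁴ _ _ _ _))
                  (sum1-distrib-+⁴ _ _ _ _)

    left : Within N leftSum V
    left = within-≡ (trans (cong (_+ atPred row (suc N)) (sum1-cong N λ r _ _ → sum1-atPred N r v))
                           (trans (sum1-atPred+atPred N row) (sym (+-identityʳ V))))
                    (atPred-≤ row (suc N) row≤N) z≤n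
    below : Within N belowSum V
    below = within-≡ (trans (sym (sum1-distrib-+ N _ _)) (trans (sum1-cong N λ r _ _ → sum1-atPred+atPred N (v r)) (sym (+-identityʳ V))))
                     (col≤N λ r → atPred-≤ (v r) (suc N) (v≤1 r)) z≤n
    above : Within N aboveSum V
    above = within-≡ (trans (sym (sum1-distrib-+ N _ _)) (trans (sum1-cong N λ r _ _ → sum1-shift N (v r)) (sum1-distrib-+ N _ _)))
                     (col≤N λ r → v≤1 r 1) (col≤N λ r → v≤1 r (suc N))
    right : Within N rightSum V
    right = within-≡ (sum1-shift N row) (row≤N 1) (row≤N (suc N))

    lemma : ∀ x → x + (x + x) + x ≡ 4 * x
    lemma = solve-∀

module RationalTools where

  open import Defs using (sum1)
  open import Data.Nat as ℕ using (ℕ; zero; suc)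
  import Data.Nat.Properties as ℕ
  open import Data.Integer as ℤ using (+_)
  import Data.Integer.Properties as ℤ
  open import Data.Rational.Unnormalised
  open import Data.Rational.Unnormalised.Properties
  open import Relation.Nullary.Decidable using (dec⇒maybe)
  open import Data.Sum using (inj₁; inj₂)
  open import Level using (0ℓ)
  open import Relation.Binary.PropositionalEquality as ≡ using (_≡_)
  open import Tactic.RingSolver.Core.Expression using (Expr)
  import Tactic.RingSolver.Core.AlmostCommutativeRing as ACR

  -- The zero test lets the normaliser discard monomials whose coefficients cancel.
  ℚᵘ-ring : ACR.AlmostCommutativeRing 0ℓ 0ℓ
  ℚᵘ-ring = ACR.fromCommutativeRing +-*-commutativeRing (λ x → dec⇒maybe (0ℚᵘ ≃? x))

  open import Tactic.RingSolver.NonReflective ℚᵘ-ring public using (solve; _⊜_; _⊕_; _⊗_; ⊝_; Κ)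

  infixl 6 _⊖_
  _⊖_ : ∀ {n} → Expr ℚᵘ n → Expr ℚᵘ n → Expr ℚᵘ n
  x ⊖ y = x ⊕ ⊝ y

  fromℕ : ℕ → ℚᵘ
  fromℕ n = mkℚᵘ (+ n) 0

  -- a / q; the junk value at q = 0 is a / 1.
  infix 8 _/ℕ_
  _/ℕ_ : ℕ → ℕ → ℚᵘ
  a /ℕ q = mkℚᵘ (+ a) (q ℕ.∸ 1)

  fromℕ-+ : ∀ m n → fromℕ (m ℕ.+ n) ≃ fromℕ m + fromℕ n
  fromℕ-+ m n = *≡* (≡.cong (ℤ._* + 1) (≡.trans (ℤ.pos-+ m n)
                      (≡.sym (≡.cong₂ ℤ._+_ (ℤ.*-identityʳ (+ m)) (ℤ.*-identityʳ (+ n))))))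

  fromℕ-* : ∀ m n → fromℕ (m ℕ.* n) ≃ fromℕ m * fromℕ n
  fromℕ-* m n = *≡* (≡.cong (ℤ._* + 1) (ℤ.pos-* m n))

  fromℕ-mono-≤ : ∀ {m n} → m ℕ.≤ n → fromℕ m ≤ fromℕ n
  fromℕ-mono-≤ m≤n = *≤* (ℤ.*-monoʳ-≤-nonNeg (+ 1) (ℤ.+≤+ m≤n))

  fromℕ-nonNeg : ∀ n → 0ℚᵘ ≤ fromℕ n
  fromℕ-nonNeg n = fromℕ-mono-≤ ℕ.z≤n

  /ℕ-nonNeg : ∀ a q → 0ℚᵘ ≤ a /ℕ q
  /ℕ-nonNeg a q = nonNegative⁻¹ (a /ℕ q)

  /ℕ-mono-≤ : ∀ a c q d → 1 ℕ.≤ q → 1 ℕ.≤ d → a ℕ.* d ℕ.≤ c ℕ.* q → a /ℕ q ≤ c /ℕ d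
  /ℕ-mono-≤ a c (suc q) (suc d) _ _ ad≤cq = *≤* (≡.subst₂ ℤ._≤_ (ℤ.pos-* a (suc d)) (ℤ.pos-* c (suc q)) (ℤ.+≤+ ad≤cq))

  /ℕ-mono-< : ∀ a c q d → 1 ℕ.≤ q → 1 ℕ.≤ d → a ℕ.* d ℕ.< c ℕ.* q → a /ℕ q < c /ℕ d
  /ℕ-mono-< a c (suc q) (suc d) _ _ ad<cq = *<* (≡.subst₂ ℤ._<_ (ℤ.pos-* a (suc d)) (ℤ.pos-* c (suc q)) (ℤ.+<+ ad<cq))

  /ℕ-+ : ∀ a c q d → 1 ℕ.≤ q → 1 ℕ.≤ d → a /ℕ q + c /ℕ d ≃ (a ℕ.* d ℕ.+ c ℕ.* q) /ℕ (q ℕ.* d)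
  /ℕ-+ a c (suc q) (suc d) _ _ = *≡* (≡.cong (ℤ._* + (suc q ℕ.* suc d))
    (≡.trans (≡.cong₂ ℤ._+_ (≡.sym (ℤ.pos-* a (suc d))) (≡.sym (ℤ.pos-* c (suc q)))) (≡.sym (ℤ.pos-+ (a ℕ.* suc d) (c ℕ.* suc q)))))

  /ℕ-* : ∀ a c q d → 1 ℕ.≤ q → 1 ℕ.≤ d → a /ℕ q * c /ℕ d ≃ (a ℕ.* c) /ℕ (q ℕ.* d)
  /ℕ-* a c (suc q) (suc d) _ _ = *≡* (≡.cong (ℤ._* + (suc q ℕ.* suc d)) (≡.sym (ℤ.pos-* a c)))

  fromℕ-*-/ℕ : ∀ a c {q} → 1 ℕ.≤ q → fromℕ a * c /ℕ q ≃ (a ℕ.* c) /ℕ q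
  fromℕ-*-/ℕ a c {suc q} _ = *≡* (≡.trans (≡.cong (ℤ._* + suc q) (≡.sym (ℤ.pos-* a c)))
                                          (≡.cong (λ z → + (a ℕ.* c) ℤ.* + z) (≡.sym (ℕ.*-identityˡ (suc q)))))

  n*[1/n]≃1 : ∀ {n} → 1 ℕ.≤ n → fromℕ n * 1 /ℕ n ≃ 1ℚᵘ
  n*[1/n]≃1 {suc n} 1≤n = ≃-trans (fromℕ-*-/ℕ (suc n) 1 1≤n)
    (*≡* (≡.trans (ℤ.*-identityʳ _) (≡.trans (≡.cong +_ (ℕ.*-identityʳ (suc n))) (≡.sym (ℤ.*-identityˡ _)))))

  *-monoˡ-≤-≥0 : ∀ {p q r} → 0ℚᵘ ≤ r → p ≤ q → p * r ≤ q * r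
  *-monoˡ-≤-≥0 {r = r} 0≤r = *-monoˡ-≤-nonNeg r {{nonNegative 0≤r}}

  *-monoʳ-≤-≥0 : ∀ {p q r} → 0ℚᵘ ≤ r → p ≤ q → r * p ≤ r * q
  *-monoʳ-≤-≥0 {r = r} 0≤r = *-monoʳ-≤-nonNeg r {{nonNegative 0≤r}}

  *-≥0 : ∀ {p q} → 0ℚᵘ ≤ p → 0ℚᵘ ≤ q → 0ℚᵘ ≤ p * q
  *-≥0 {p} {q} 0≤p 0≤q = ≤-trans (≤-reflexive (≃-sym (*-zeroˡ q))) (*-monoˡ-≤-≥0 0≤q 0≤p)

  +-≥0 : ∀ {p q} → 0ℚᵘ ≤ p → 0ℚᵘ ≤ q → 0ℚᵘ ≤ p + q
  +-≥0 = +-mono-≤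

  ∣p∣≤q : ∀ {p q} → p ≤ q → - p ≤ q → ∣ p ∣ ≤ q
  ∣p∣≤q {p} p≤q -p≤q with ∣p∣≡p∨∣p∣≡-p p
  ... | inj₁ ∣p∣≡p  = ≡.subst (_≤ _) (≡.sym ∣p∣≡p) p≤q
  ... | inj₂ ∣p∣≡-p = ≡.subst (_≤ _) (≡.sym ∣p∣≡-p) -p≤q

  ∣p-q∣≤r : ∀ {p q r} → 0ℚᵘ ≤ p → p ≤ r → 0ℚᵘ ≤ q → q ≤ r → ∣ p - q ∣ ≤ r
  ∣p-q∣≤r {p} {q} {r} 0≤p p≤r 0≤q q≤r = ∣p∣≤q
    (≤-trans (+-monoʳ-≤ p (neg-mono-≤ 0≤q)) (≤-trans (≤-reflexive (+-identityʳ p)) p≤r))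
    (≤-trans (≤-reflexive (neg-distrib p q)) (≤-trans (+-monoʳ-≤ q (neg-mono-≤ 0≤p)) (≤-trans (≤-reflexive (+-identityʳ q)) q≤r)))
    where
    neg-distrib : ∀ x y → - (x - y) ≃ y - x
    neg-distrib = solve 2 (λ x y → (⊝ (x ⊖ y)) ⊜ (y ⊖ x)) ≃-refl

  ∣p*q∣≃∣p∣*q : ∀ p {q} → 0ℚᵘ ≤ q → ∣ p * q ∣ ≃ ∣ p ∣ * q
  ∣p*q∣≃∣p∣*q p {q} 0≤q = ≃-trans (∣p*q∣≃∣p∣*∣q∣ p q) (*-congˡ {∣ p ∣} (0≤p⇒∣p∣≃p 0≤q))

  ∣fromℕ-fromℕ∣≤ : ∀ {a c e} → a ℕ.≤ c ℕ.+ e → c ℕ.≤ a ℕ.+ e → ∣ fromℕ a - fromℕ c ∣ ≤ fromℕ e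
  ∣fromℕ-fromℕ∣≤ {a} {c} {e} a≤c+e c≤a+e = ∣p∣≤q (bound a c a≤c+e) (≤-trans (≤-reflexive (neg-distrib (fromℕ a) (fromℕ c))) (bound c a c≤a+e))
    where
    neg-distrib : ∀ x y → - (x - y) ≃ y - x
    neg-distrib = solve 2 (λ x y → (⊝ (x ⊖ y)) ⊜ (y ⊖ x)) ≃-refl
    cancel : ∀ x y → x + y - x ≃ y
    cancel = solve 2 (λ x y → (x ⊕ y ⊖ x) ⊜ y) ≃-refl
    bound : ∀ x y → x ℕ.≤ y ℕ.+ e → fromℕ x - fromℕ y ≤ fromℕ e
    bound x y x≤y+e = ≤-trans (+-monoˡ-≤ (- fromℕ y) (≤-trans (fromℕ-mono-≤ x≤y+e) (≤-reflexive (fromℕ-+ y e))))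
                              (≤-reflexive (cancel (fromℕ y) (fromℕ e)))

  sumℚ : ℕ → (ℕ → ℚᵘ) → ℚᵘ
  sumℚ zero    f = 0ℚᵘ
  sumℚ (suc n) f = sumℚ n f + f (suc n)

  fromℕ-sum1 : ∀ n (f : ℕ → ℕ) → fromℕ (sum1 n f) ≃ sumℚ n (λ i → fromℕ (f i))
  fromℕ-sum1 zero    f = ≃-refl
  fromℕ-sum1 (suc n) f = ≃-trans (fromℕ-+ (sum1 n f) (f (suc n))) (+-congˡ _ (fromℕ-sum1 n f))

  sumℚ-mono-≤ : ∀ n {f g : ℕ → ℚᵘ} → (∀ i → 1 ℕ.≤ i → i ℕ.≤ n → f i ≤ g i) → sumℚ n f ≤ sumℚ n g
  sumℚ-mono-≤ zero    f≤g = ≤-refl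
  sumℚ-mono-≤ (suc n) f≤g = +-mono-≤ (sumℚ-mono-≤ n λ i 1≤i i≤n → f≤g i 1≤i (ℕ.m≤n⇒m≤1+n i≤n)) (f≤g (suc n) (ℕ.s≤s ℕ.z≤n) ℕ.≤-refl)

  sumℚ-const : ∀ n c → sumℚ n (λ _ → c) ≃ fromℕ n * c
  sumℚ-const zero    c = ≃-sym (*-zeroˡ c)
  sumℚ-const (suc n) c = begin-equality
    sumℚ n (λ _ → c) + c      ≃⟨ +-congˡ _ (sumℚ-const n c) ⟩
    fromℕ n * c + c           ≃⟨ lemma (fromℕ n) c ⟩
    (fromℕ n + 1ℚᵘ) * c       ≃⟨ *-congʳ {c} (fromℕ-+ n 1) ⟨
    fromℕ (n ℕ.+ 1) * c       ≡⟨ ≡.cong (λ m → fromℕ m * c) (ℕ.+-comm n 1) ⟩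
    fromℕ (suc n) * c         ∎
    where
    open ≤-Reasoning
    lemma : ∀ a c → a * c + c ≃ (a + 1ℚᵘ) * c
    lemma = solve 2 (λ a c → (a ⊗ c ⊕ c) ⊜ ((a ⊕ (Κ 1ℚᵘ)) ⊗ c)) ≃-refl

  sumℚ-nonNeg : ∀ n {f : ℕ → ℚᵘ} → (∀ i → 0ℚᵘ ≤ f i) → 0ℚᵘ ≤ sumℚ n f
  sumℚ-nonNeg n {f} 0≤f = ≤-trans (≤-reflexive (≃-sym (≃-trans (sumℚ-const n 0ℚᵘ) (*-zeroʳ (fromℕ n)))))
                                  (sumℚ-mono-≤ n λ i _ _ → 0≤f i)

  sumℚ-distrib-- : ∀ n (f g : ℕ → ℚᵘ) → sumℚ n (λ i → f i - g i) ≃ sumℚ n f - sumℚ n g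
  sumℚ-distrib-- zero    f g = ≃-refl
  sumℚ-distrib-- (suc n) f g = ≃-trans (+-congˡ _ (sumℚ-distrib-- n f g)) (lemma (sumℚ n f) (sumℚ n g) (f (suc n)) (g (suc n)))
    where
    lemma : ∀ a b c d → a - b + (c - d) ≃ a + c - (b + d)
    lemma = solve 4 (λ a b c d → (a ⊖ b ⊕ (c ⊖ d)) ⊜ (a ⊕ c ⊖ (b ⊕ d))) ≃-refl

  *-distribˡ-sumℚ : ∀ n c (f : ℕ → ℚᵘ) → c * sumℚ n f ≃ sumℚ n (λ i → c * f i)
  *-distribˡ-sumℚ zero    c f = *-zeroʳ c
  *-distribˡ-sumℚ (suc n) c f = ≃-trans (*-distribˡ-+ c (sumℚ n f) (f (suc n))) (+-congˡ _ (*-distribˡ-sumℚ n c f))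

  ∣sumℚ∣≤sumℚ∣∣ : ∀ n (f : ℕ → ℚᵘ) → ∣ sumℚ n f ∣ ≤ sumℚ n (λ i → ∣ f i ∣)
  ∣sumℚ∣≤sumℚ∣∣ zero    f = ≤-refl
  ∣sumℚ∣≤sumℚ∣∣ (suc n) f = ≤-trans (∣p+q∣≤∣p∣+∣q∣ (sumℚ n f) (f (suc n))) (+-monoˡ-≤ ∣ f (suc n) ∣ (∣sumℚ∣≤sumℚ∣∣ n f))

  sumℚ-split : ∀ a n (f : ℕ → ℚᵘ) → sumℚ (a ℕ.+ n) f ≃ sumℚ a f + sumℚ n (λ i → f (a ℕ.+ i))
  sumℚ-split a zero    f = ≃-trans (≃-reflexive (≡.cong (λ m → sumℚ m f) (ℕ.+-identityʳ a))) (≃-sym (+-identityʳ (sumℚ a f)))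
  sumℚ-split a (suc n) f = begin-equality
    sumℚ (a ℕ.+ suc n) f                                          ≡⟨ ≡.cong (λ m → sumℚ m f) (ℕ.+-suc a n) ⟩
    sumℚ (a ℕ.+ n) f + f (suc (a ℕ.+ n))                          ≃⟨ +-congˡ _ (sumℚ-split a n f) ⟩
    sumℚ a f + sumℚ n (λ i → f (a ℕ.+ i)) + f (suc (a ℕ.+ n))     ≃⟨ +-assoc (sumℚ a f) _ _ ⟩
    sumℚ a f + (sumℚ n (λ i → f (a ℕ.+ i)) + f (suc (a ℕ.+ n)))   ≡⟨ ≡.cong (λ m → sumℚ a f + (sumℚ n (λ i → f (a ℕ.+ i)) + f m)) (ℕ.+-suc a n) ⟨
    sumℚ a f + sumℚ (suc n) (λ i → f (a ℕ.+ i))                   ∎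
    where open ≤-Reasoning

  c*a≤d⇒a≤d/c : ∀ {a c d} → 1 ℕ.≤ c → c ℕ.* a ℕ.≤ d → fromℕ a ≤ fromℕ d * 1 /ℕ c
  c*a≤d⇒a≤d/c {a} {c} {d} 1≤c ca≤d = begin
    fromℕ a                          ≃⟨ ≃-sym (*-identityʳ (fromℕ a)) ⟩
    fromℕ a * 1ℚᵘ                    ≃⟨ *-congˡ {fromℕ a} (n*[1/n]≃1 1≤c) ⟨
    fromℕ a * (fromℕ c * 1 /ℕ c)     ≃⟨ lemma (fromℕ a) (fromℕ c) (1 /ℕ c) ⟩
    fromℕ c * fromℕ a * 1 /ℕ c       ≃⟨ *-congʳ {1 /ℕ c} (fromℕ-* c a) ⟨
    fromℕ (c ℕ.* a) * 1 /ℕ c         ≤⟨ *-monoˡ-≤-≥0 (/ℕ-nonNeg 1 c) (fromℕ-mono-≤ ca≤d) ⟩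
    fromℕ d * 1 /ℕ c                 ∎
    where
    open ≤-Reasoning
    lemma : ∀ a c i → a * (c * i) ≃ c * a * i
    lemma = solve 3 (λ a c i → (a ⊗ (c ⊗ i)) ⊜ (c ⊗ a ⊗ i)) ≃-refl

  d≤c*a⇒d/c≤a : ∀ {a c d} → 1 ℕ.≤ c → d ℕ.≤ c ℕ.* a → fromℕ d * 1 /ℕ c ≤ fromℕ a
  d≤c*a⇒d/c≤a {a} {c} {d} 1≤c d≤ca = begin
    fromℕ d * 1 /ℕ c                 ≤⟨ *-monoˡ-≤-≥0 (/ℕ-nonNeg 1 c) (fromℕ-mono-≤ d≤ca) ⟩
    fromℕ (c ℕ.* a) * 1 /ℕ c         ≃⟨ *-congʳ {1 /ℕ c} (fromℕ-* c a) ⟩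
    fromℕ c * fromℕ a * 1 /ℕ c       ≃⟨ lemma (fromℕ a) (fromℕ c) (1 /ℕ c) ⟨
    fromℕ a * (fromℕ c * 1 /ℕ c)     ≃⟨ *-congˡ {fromℕ a} (n*[1/n]≃1 1≤c) ⟩
    fromℕ a * 1ℚᵘ                    ≃⟨ *-identityʳ (fromℕ a) ⟩
    fromℕ a                          ∎
    where
    open ≤-Reasoning
    lemma : ∀ a c i → a * (c * i) ≃ c * a * i
    lemma = solve 3 (λ a c i → (a ⊗ (c ⊗ i)) ⊜ (c ⊗ a ⊗ i)) ≃-refl

module ZetaPartialSums where

  open import Defs using (zetaPartial)
  open RationalTools
  open import Data.Nat as ℕ using (ℕ; zero; suc; _^_)
  import Data.Nat.Properties as ℕ
  open import Data.Nat.Tactic.RingSolver using () renaming (solve-∀ to solveℕ-∀)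
  open import Data.Rational.Unnormalised
  open import Data.Rational.Unnormalised.Properties
  open import Relation.Binary.PropositionalEquality as ≡ using (_≡_)

  zetaTerm : ℕ → ℕ → ℚᵘ
  zetaTerm b k = 1 /ℕ (k ^ (b ℕ.+ 1))

  ζ : ℕ → ℕ → ℚᵘ
  ζ b K = sumℚ K (zetaTerm b)

  zetaPartial≡ζ : ∀ b K → zetaPartial b K ≡ ζ b K
  zetaPartial≡ζ b zero    = ≡.refl
  zetaPartial≡ζ b (suc K) = ≡.cong (_+ zetaTerm b (suc K)) (zetaPartial≡ζ b K)

  zetaTerm-nonNeg : ∀ b k → 0ℚᵘ ≤ zetaTerm b k
  zetaTerm-nonNeg b k = /ℕ-nonNeg 1 (k ^ (b ℕ.+ 1))

  zetaTerm≤1/k² : ∀ b {k} → 1 ℕ.≤ b → 1 ℕ.≤ k → zetaTerm b k ≤ 1 /ℕ (k ℕ.* k)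
  zetaTerm≤1/k² b {k} 1≤b 1≤k = /ℕ-mono-≤ 1 1 (k ^ (b ℕ.+ 1)) (k ℕ.* k) (ℕ.m^n>0 k {{ℕ.>-nonZero 1≤k}} (b ℕ.+ 1)) (ℕ.*-mono-≤ 1≤k 1≤k)
    (ℕ.*-monoʳ-≤ 1 (≡.subst (ℕ._≤ k ^ (b ℕ.+ 1)) (≡.cong (k ℕ.*_) (ℕ.*-identityʳ k))
                     (ℕ.^-monoʳ-≤ k {{ℕ.>-nonZero 1≤k}} (ℕ.+-monoˡ-≤ 1 1≤b))))

  1/[1+m]²+1/[1+m]≤1/m : ∀ {m} → 1 ℕ.≤ m → 1 /ℕ (suc m ℕ.* suc m) + 1 /ℕ suc m ≤ 1 /ℕ m
  1/[1+m]²+1/[1+m]≤1/m {suc m} _ = ≤-trans (≤-reflexive (/ℕ-+ 1 1 (suc (suc m) ℕ.* suc (suc m)) (suc (suc m)) (ℕ.s≤s ℕ.z≤n) (ℕ.s≤s ℕ.z≤n)))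
    (/ℕ-mono-≤ _ 1 _ (suc m) (ℕ.s≤s ℕ.z≤n) (ℕ.s≤s ℕ.z≤n) (ℕ.≤-trans (ℕ.m≤m+n _ (suc (suc m))) (ℕ.≤-reflexive (lemma m))))
    where
    lemma : ∀ m → (1 ℕ.* suc (suc m) ℕ.+ 1 ℕ.* (suc (suc m) ℕ.* suc (suc m))) ℕ.* suc m ℕ.+ suc (suc m)
                  ≡ 1 ℕ.* (suc (suc m) ℕ.* suc (suc m) ℕ.* suc (suc m))
    lemma = solveℕ-∀

  -- Telescoping: 1/k^{b+1} ≤ 1/k² ≤ 1/(k-1) - 1/k.
  ζ-tail+1/[a+n]≤1/a : ∀ b a n → 1 ℕ.≤ b → 1 ℕ.≤ a → sumℚ n (λ i → zetaTerm b (a ℕ.+ i)) + 1 /ℕ (a ℕ.+ n) ≤ 1 /ℕ a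
  ζ-tail+1/[a+n]≤1/a b a zero    _   _   = ≤-reflexive (≃-trans (+-identityˡ _) (≃-reflexive (≡.cong (1 /ℕ_) (ℕ.+-identityʳ a))))
  ζ-tail+1/[a+n]≤1/a b a (suc n) 1≤b 1≤a = begin
    tail + zetaTerm b (a ℕ.+ suc n) + 1 /ℕ (a ℕ.+ suc n)  ≡⟨ ≡.cong (λ m → tail + zetaTerm b m + 1 /ℕ m) (ℕ.+-suc a n) ⟩
    tail + zetaTerm b (suc m) + 1 /ℕ suc m                ≃⟨ +-assoc tail _ _ ⟩
    tail + (zetaTerm b (suc m) + 1 /ℕ suc m)              ≤⟨ +-monoʳ-≤ tail (+-monoˡ-≤ (1 /ℕ suc m) (zetaTerm≤1/k² b 1≤b (ℕ.s≤s ℕ.z≤n))) ⟩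
    tail + (1 /ℕ (suc m ℕ.* suc m) + 1 /ℕ suc m)          ≤⟨ +-monoʳ-≤ tail (1/[1+m]²+1/[1+m]≤1/m (ℕ.≤-trans 1≤a (ℕ.m≤m+n a n))) ⟩
    tail + 1 /ℕ m                                         ≤⟨ ζ-tail+1/[a+n]≤1/a b a n 1≤b 1≤a ⟩
    1 /ℕ a                                                ∎
    where
    open ≤-Reasoning
    tail : ℚᵘ
    tail = sumℚ n (λ i → zetaTerm b (a ℕ.+ i))
    m : ℕ
    m = a ℕ.+ n

  ζ-tail≤1/a : ∀ b a n → 1 ℕ.≤ b → 1 ℕ.≤ a → sumℚ n (λ i → zetaTerm b (a ℕ.+ i)) ≤ 1 /ℕ a
  ζ-tail≤1/a b a n 1≤b 1≤a = ≤-trans (p≤p+q _ (1 /ℕ (a ℕ.+ n))) (ζ-tail+1/[a+n]≤1/a b a n 1≤b 1≤a)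

  ζ-suc : ∀ b K → ζ b (suc K) ≃ 1ℚᵘ + sumℚ K (λ i → zetaTerm b (1 ℕ.+ i))
  ζ-suc b K = ≃-trans (sumℚ-split 1 K (zetaTerm b))
                      (+-congˡ (sumℚ K λ i → zetaTerm b (1 ℕ.+ i)) (≃-trans (+-identityˡ _) (≃-reflexive (≡.cong (1 /ℕ_) (ℕ.^-zeroˡ (b ℕ.+ 1))))))

  ζ-from-2≤3/4 : ∀ b K → 1 ℕ.≤ b → sumℚ K (λ i → zetaTerm b (1 ℕ.+ i)) ≤ 3 /ℕ 4
  ζ-from-2≤3/4 b zero    _   = /ℕ-nonNeg 3 4
  ζ-from-2≤3/4 b (suc K) 1≤b = begin
    sumℚ (1 ℕ.+ K) (λ i → zetaTerm b (1 ℕ.+ i))         ≃⟨ sumℚ-split 1 K _ ⟩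
    0ℚᵘ + zetaTerm b 2 + sumℚ K (λ i → zetaTerm b (2 ℕ.+ i)) ≤⟨ +-mono-≤ (≤-trans (≤-reflexive (+-identityˡ _)) (zetaTerm≤1/k² b 1≤b (ℕ.s≤s ℕ.z≤n)))
                                                                    (ζ-tail≤1/a b 2 K 1≤b (ℕ.s≤s ℕ.z≤n)) ⟩
    1 /ℕ 4 + 1 /ℕ 2                                      ≃⟨ *≡* ≡.refl ⟩
    3 /ℕ 4                                               ∎
    where open ≤-Reasoning

  ζ≥1 : ∀ b K → 1ℚᵘ ≤ ζ b (suc K)
  ζ≥1 b K = ≤-trans (p≤p+q 1ℚᵘ (sumℚ K λ i → zetaTerm b (1 ℕ.+ i)) {{nonNegative (sumℚ-nonNeg K λ i → zetaTerm-nonNeg b (1 ℕ.+ i))}})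
                    (≤-reflexive (≃-sym (ζ-suc b K)))

module FloorBounds where

  open VisibleCount using (⌊_/_⌋)
  open import Data.Nat
  open import Data.Nat.Properties
  open import Data.Nat.DivMod using (_/_; _%_; m≡m%n+[m/n]*n; m%n<n; m/n*n≤m; m/n≤m; m*n/n≡m; /-monoˡ-≤)
  open import Data.Nat.Tactic.RingSolver using (solve-∀)
  open import Data.Sum using (inj₁; inj₂)
  open import Relation.Binary.PropositionalEquality

  ⌊x/k⌋*k≤x : ∀ x {k} → 1 ≤ k → ⌊ x / k ⌋ * k ≤ x
  ⌊x/k⌋*k≤x x {suc k} _ = m/n*n≤m x (suc k)

  x≤⌊x/k⌋*k+k : ∀ x {k} → 1 ≤ k → x ≤ ⌊ x / k ⌋ * k + k
  x≤⌊x/k⌋*k+k x {suc k} _ = begin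
    x                              ≡⟨ m≡m%n+[m/n]*n x (suc k) ⟩
    x % suc k + x / suc k * suc k  ≤⟨ +-monoˡ-≤ _ (<⇒≤ (m%n<n x (suc k))) ⟩
    suc k + x / suc k * suc k      ≡⟨ +-comm (suc k) _ ⟩
    x / suc k * suc k + suc k      ∎
    where open ≤-Reasoning

  ⌊x/k⌋≤x : ∀ x {k} → 1 ≤ k → ⌊ x / k ⌋ ≤ x
  ⌊x/k⌋≤x x {suc k} _ = m/n≤m x (suc k)

  a*k≤x⇒a≤⌊x/k⌋ : ∀ {a x k} → 1 ≤ k → a * k ≤ x → a ≤ ⌊ x / k ⌋
  a*k≤x⇒a≤⌊x/k⌋ {a} {x} {suc k} _ ak≤x = ≤-trans (≤-reflexive (sym (m*n/n≡m a (suc k)))) (/-monoˡ-≤ (suc k) ak≤x)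

  k^[b+1]≡k*k^b : ∀ k b → k ^ (b + 1) ≡ k * k ^ b
  k^[b+1]≡k*k^b k b = trans (^-distribˡ-+-* k b 1) (trans (cong (k ^ b *_) (*-identityʳ k)) (*-comm (k ^ b) k))

  module FloorProduct (b x y : ℕ) {k : ℕ} (1≤k : 1 ≤ k) where

    q r : ℕ
    q = ⌊ x / k ⌋
    r = ⌊ y / k ^ b ⌋
    1≤kᵇ : 1 ≤ k ^ b
    1≤kᵇ = m^n>0 k {{>-nonZero 1≤k}} b

    k^[b+1]*qr≤xy : k ^ (b + 1) * (q * r) ≤ x * y
    k^[b+1]*qr≤xy = begin
      k ^ (b + 1) * (q * r)     ≡⟨ cong (_* (q * r)) (k^[b+1]≡k*k^b k b) ⟩
      k * k ^ b * (q * r)       ≡⟨ lemma k (k ^ b) q r ⟩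
      q * k * (r * k ^ b)       ≤⟨ *-mono-≤ (⌊x/k⌋*k≤x x 1≤k) (⌊x/k⌋*k≤x y 1≤kᵇ) ⟩
      x * y                     ∎
      where
      open ≤-Reasoning
      lemma : ∀ k kᵇ q r → k * kᵇ * (q * r) ≡ q * k * (r * kᵇ)
      lemma = solve-∀

    xy≤k^[b+1]*[qr+x+y+1] : x * y ≤ k ^ (b + 1) * (q * r + (x + y + 1))
    xy≤k^[b+1]*[qr+x+y+1] = begin
      x * y                                   ≤⟨ *-mono-≤ (x≤⌊x/k⌋*k+k x 1≤k) (x≤⌊x/k⌋*k+k y 1≤kᵇ) ⟩
      (q * k + k) * (r * k ^ b + k ^ b)       ≡⟨ expand k (k ^ b) q r ⟩
      k * k ^ b * (q * r + q + r + 1)         ≤⟨ *-monoʳ-≤ (k * k ^ b) (+-monoˡ-≤ 1 (+-mono-≤ (+-monoʳ-≤ (q * r) (⌊x/k⌋≤x x 1≤k)) (⌊x/k⌋≤x y 1≤kᵇ))) ⟩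
      k * k ^ b * (q * r + x + y + 1)         ≡⟨ cong₂ _*_ (k^[b+1]≡k*k^b k b) (reassoc (q * r) x y) ⟨
      k ^ (b + 1) * (q * r + (x + y + 1))     ∎
      where
      open ≤-Reasoning
      expand : ∀ k kᵇ q r → (q * k + k) * (r * kᵇ + kᵇ) ≡ k * kᵇ * (q * r + q + r + 1)
      expand = solve-∀
      reassoc : ∀ a x y → a + (x + y + 1) ≡ a + x + y + 1
      reassoc = solve-∀

  K²[x+y+1]≤xy-ordered : ∀ {K x y} → 1 ≤ K → 3 * K * K ≤ x → x ≤ y → K * K * (x + y + 1) ≤ x * y
  K²[x+y+1]≤xy-ordered {K} {x} {y} 1≤K 3K²≤x x≤y = begin
    K * K * (x + y + 1)   ≤⟨ *-monoʳ-≤ (K * K) (+-mono-≤ (+-monoˡ-≤ y x≤y) 1≤y) ⟩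
    K * K * (y + y + y)   ≡⟨ lemma K y ⟩
    3 * K * K * y         ≤⟨ *-monoˡ-≤ y 3K²≤x ⟩
    x * y                 ∎
    where
    open ≤-Reasoning
    1≤y : 1 ≤ y
    1≤y = ≤-trans (*-mono-≤ (*-mono-≤ (s≤s (z≤n {2})) 1≤K) 1≤K) (≤-trans 3K²≤x x≤y)
    lemma : ∀ K y → K * K * (y + y + y) ≡ 3 * K * K * y
    lemma = solve-∀

  K²[x+y+1]≤xy : ∀ {K x y} → 1 ≤ K → 3 * K * K ≤ x → 3 * K * K ≤ y → K * K * (x + y + 1) ≤ x * y
  K²[x+y+1]≤xy {K} {x} {y} 1≤K 3K²≤x 3K²≤y with ≤-total x y
  ... | inj₁ x≤y = K²[x+y+1]≤xy-ordered 1≤K 3K²≤x x≤y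
  ... | inj₂ y≤x = subst₂ _≤_ (cong (λ z → K * K * (z + 1)) (+-comm y x)) (*-comm y x) (K²[x+y+1]≤xy-ordered 1≤K 3K²≤y y≤x)

  -- Thresholds X j, each K^b times the previous one, so that one level of the
  -- recursion x ↦ ⌊x/k⌋, y ↦ ⌊y/kᵇ⌋ with k ≤ K moves down by at most one threshold.
  module Thresholds (b K : ℕ) (1≤b : 1 ≤ b) (1≤K : 1 ≤ K) where

    X : ℕ → ℕ
    X zero    = 3 * K * K
    X (suc j) = K ^ b * X j

    1≤Kᵇ : 1 ≤ K ^ b
    1≤Kᵇ = m^n>0 K {{>-nonZero 1≤K}} b

    K≤Kᵇ : K ≤ K ^ b
    K≤Kᵇ = ≤-trans (≤-reflexive (sym (^-identityʳ K))) (^-monoʳ-≤ K {{>-nonZero 1≤K}} 1≤b)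

    3K²≤X : ∀ j → 3 * K * K ≤ X j
    3K²≤X zero    = ≤-refl
    3K²≤X (suc j) = ≤-trans (3K²≤X j) (m≤n*m (X j) (K ^ b) {{>-nonZero 1≤Kᵇ}})

    K≤X : ∀ j → K ≤ X j
    K≤X j = ≤-trans (m≤n*m K (3 * K) {{>-nonZero (*-mono-≤ (s≤s (z≤n {2})) 1≤K)}}) (3K²≤X j)

    X≤⌊x/k⌋ : ∀ j {x k} → 1 ≤ k → k ≤ K → X (suc j) ≤ x → X j ≤ ⌊ x / k ⌋
    X≤⌊x/k⌋ j {x} {k} 1≤k k≤K X≤x = a*k≤x⇒a≤⌊x/k⌋ 1≤k (begin
      X j * k       ≤⟨ *-monoʳ-≤ (X j) (≤-trans k≤K K≤Kᵇ) ⟩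
      X j * K ^ b   ≡⟨ *-comm (X j) (K ^ b) ⟩
      X (suc j)     ≤⟨ X≤x ⟩
      x             ∎)
      where open ≤-Reasoning

    X≤⌊y/kᵇ⌋ : ∀ j {y k} → 1 ≤ k → k ≤ K → X (suc j) ≤ y → X j ≤ ⌊ y / k ^ b ⌋
    X≤⌊y/kᵇ⌋ j {y} {k} 1≤k k≤K X≤y = a*k≤x⇒a≤⌊x/k⌋ (m^n>0 k {{>-nonZero 1≤k}} b) (begin
      X j * k ^ b   ≤⟨ *-monoʳ-≤ (X j) (^-monoˡ-≤ b k≤K) ⟩
      X j * K ^ b   ≡⟨ *-comm (X j) (K ^ b) ⟩
      X (suc j)     ≤⟨ X≤y ⟩
      y             ∎)
      where open ≤-Reasoning

module RelativeError where

  open import Defs using (sum1)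
  open VisibleCount using (⌊_/_⌋; countVisible; countVisible≤; x*y≡sum-countVisible)
  open FloorBounds
  open RationalTools
  open ZetaPartialSums
  open import Data.Nat as ℕ using (ℕ; zero; suc; _^_)
  import Data.Nat.Properties as ℕ
  open import Data.Nat.DivMod using (n/1≡n)
  open import Data.Integer using (+≤+)
  open import Data.Rational.Unnormalised hiding (_/_)
  open import Data.Rational.Unnormalised.Properties
  open import Relation.Binary.PropositionalEquality as ≡ using (_≡_)

  module Bootstrap (b Kp : ℕ) (1≤b : 1 ℕ.≤ b) where

    K : ℕ
    K = suc Kp
    1≤K : 1 ℕ.≤ K
    1≤K = ℕ.s≤s ℕ.z≤n
    open Thresholds b K 1≤b 1≤K public

    Z 1/K 3/4 : ℚᵘ
    Z = ζ b K
    1/K = 1 /ℕ K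
    3/4 = 3 /ℕ 4

    Z≥1 : 1ℚᵘ ≤ Z
    Z≥1 = ζ≥1 b Kp

    Z≥0 : 0ℚᵘ ≤ Z
    Z≥0 = ≤-trans (*≤* (+≤+ ℕ.z≤n)) Z≥1

    θ : ℕ → ℚᵘ
    θ zero    = 1ℚᵘ
    θ (suc j) = 3/4 * θ j + (1/K + 1/K)

    θ-nonNeg : ∀ j → 0ℚᵘ ≤ θ j
    θ-nonNeg zero    = *≤* (+≤+ ℕ.z≤n)
    θ-nonNeg (suc j) = +-≥0 (*-≥0 (/ℕ-nonNeg 3 4) (θ-nonNeg j)) (+-≥0 (/ℕ-nonNeg 1 K) (/ℕ-nonNeg 1 K))

    discrepancy : ℕ → ℕ → ℚᵘ
    discrepancy x y = Z * fromℕ (countVisible b x y) - fromℕ (x ℕ.* y)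

    Bound : ℕ → ℕ → ℕ → Set
    Bound j x y = ∣ discrepancy x y ∣ ≤ θ j * (Z * fromℕ (x ℕ.* y))

    -- Both Z·V(x, y) and xy lie in [0, Z·xy].
    bound-zero : ∀ x y → Bound 0 x y
    bound-zero x y = ≤-trans (∣p-q∣≤r (*-≥0 Z≥0 (fromℕ-nonNeg _)) (*-monoʳ-≤-≥0 Z≥0 (fromℕ-mono-≤ (countVisible≤ b x y)))
                                       (fromℕ-nonNeg _) (≤-trans (≤-reflexive (≃-sym (*-identityˡ _))) (*-monoˡ-≤-≥0 (fromℕ-nonNeg _) Z≥1)))
                             (≤-reflexive (≃-sym (*-identityˡ _)))

    module Step (j : ℕ) (IH : ∀ {x y} → X j ℕ.≤ x → X j ℕ.≤ y → Bound j x y)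
                {x y : ℕ} (X≤x : X (suc j) ℕ.≤ x) (X≤y : X (suc j) ℕ.≤ y) where

      P e : ℚᵘ
      P = fromℕ (x ℕ.* y)
      e = fromℕ (x ℕ.+ y ℕ.+ 1)

      P≥0 : 0ℚᵘ ≤ P
      P≥0 = fromℕ-nonNeg (x ℕ.* y)

      V : ℕ → ℚᵘ
      V k = fromℕ (countVisible b ⌊ x / k ⌋ ⌊ y / k ^ b ⌋)

      p : ℕ → ℚᵘ
      p k = fromℕ (⌊ x / k ⌋ ℕ.* ⌊ y / k ^ b ⌋)

      L : ℕ
      L = x ℕ.∸ K

      S₂ S₃ W Σp : ℚᵘ
      S₂ = sumℚ Kp (λ i → V (1 ℕ.+ i))
      S₃ = sumℚ L (λ i → V (K ℕ.+ i))
      W = sumℚ Kp (λ i → zetaTerm b (1 ℕ.+ i))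
      Σp = sumℚ Kp (λ i → p (1 ℕ.+ i))

      V₁≃V : V 1 ≃ fromℕ (countVisible b x y)
      V₁≃V = ≃-reflexive (≡.cong₂ (λ u v → fromℕ (countVisible b u v)) (n/1≡n x) (≡.trans (≡.cong ⌊ y /_⌋ (ℕ.^-zeroˡ b)) (n/1≡n y)))

      P≃V+S₂+S₃ : P ≃ fromℕ (countVisible b x y) + S₂ + S₃
      P≃V+S₂+S₃ = begin-equality
        P                                     ≡⟨ ≡.cong fromℕ (x*y≡sum-countVisible b x y) ⟩
        fromℕ (sum1 x _)                      ≃⟨ fromℕ-sum1 x _ ⟩
        sumℚ x V                              ≡⟨ ≡.cong (λ n → sumℚ n V) (ℕ.m+[n∸m]≡n (ℕ.≤-trans (K≤X (suc j)) X≤x)) ⟨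
        sumℚ (K ℕ.+ L) V                      ≃⟨ sumℚ-split K L V ⟩
        sumℚ (1 ℕ.+ Kp) V + S₃                ≃⟨ +-congˡ S₃ (sumℚ-split 1 Kp V) ⟩
        0ℚᵘ + V 1 + S₂ + S₃                   ≃⟨ +-congˡ S₃ (+-congˡ S₂ (≃-trans (+-identityˡ (V 1)) V₁≃V)) ⟩
        fromℕ (countVisible b x y) + S₂ + S₃  ∎
        where open ≤-Reasoning

      E₁ E₂ E₃ : ℚᵘ
      E₁ = sumℚ Kp (λ i → P * zetaTerm b (1 ℕ.+ i) - p (1 ℕ.+ i))
      E₂ = sumℚ Kp (λ i → Z * V (1 ℕ.+ i) - p (1 ℕ.+ i))
      E₃ = Z * S₃

      discrepancy≃E₁-E₂-E₃ : discrepancy x y ≃ E₁ - E₂ - E₃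
      discrepancy≃E₁-E₂-E₃ = begin-equality
        Z * fromℕ (countVisible b x y) - P
          ≃⟨ +-congˡ (- P) (*-cong (ζ-suc b Kp) (≃-trans (isolate _ S₂ S₃) (+-congˡ (- S₃) (+-congˡ (- S₂) (≃-sym P≃V+S₂+S₃))))) ⟩
        (1ℚᵘ + W) * (P - S₂ - S₃) - P
          ≃⟨ regroup W P S₂ S₃ Σp ⟩
        (P * W - Σp) - ((1ℚᵘ + W) * S₂ - Σp) - (1ℚᵘ + W) * S₃
          ≃⟨ +-cong (+-cong E₁≃ (-‿cong (≃-trans E₂≃ (+-congˡ (- Σp) (*-congʳ {S₂} (ζ-suc b Kp)))))) (-‿cong (*-congʳ {S₃} (ζ-suc b Kp))) ⟨
        E₁ - E₂ - E₃ ∎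
        where
        open ≤-Reasoning
        isolate : ∀ v s t → v ≃ v + s + t - s - t
        isolate = solve 3 (λ v s t → v ⊜ (v ⊕ s ⊕ t ⊖ s ⊖ t)) ≃-refl
        regroup : ∀ w p s t σ → (1ℚᵘ + w) * (p - s - t) - p ≃ (p * w - σ) - ((1ℚᵘ + w) * s - σ) - (1ℚᵘ + w) * t
        regroup = solve 5 (λ w p s t σ → (((Κ 1ℚᵘ) ⊕ w) ⊗ (p ⊖ s ⊖ t) ⊖ p) ⊜ ((p ⊗ w ⊖ σ) ⊖ (((Κ 1ℚᵘ) ⊕ w) ⊗ s ⊖ σ) ⊖ ((Κ 1ℚᵘ) ⊕ w) ⊗ t)) ≃-refl
        E₁≃ : E₁ ≃ P * W - Σp
        E₁≃ = ≃-trans (sumℚ-distrib-- Kp _ _) (+-congˡ (- Σp) (≃-sym (*-distribˡ-sumℚ Kp P _)))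
        E₂≃ : E₂ ≃ Z * S₂ - Σp
        E₂≃ = ≃-trans (sumℚ-distrib-- Kp _ _) (+-congˡ (- Σp) (≃-sym (*-distribˡ-sumℚ Kp Z _)))

      k^[b+1]≥1 : ∀ k → 1 ℕ.≤ k → 1 ℕ.≤ k ^ (b ℕ.+ 1)
      k^[b+1]≥1 k 1≤k = ℕ.m^n>0 k {{ℕ.>-nonZero 1≤k}} (b ℕ.+ 1)

      p≤P*zetaTerm : ∀ k → 1 ℕ.≤ k → p k ≤ P * zetaTerm b k
      p≤P*zetaTerm k 1≤k = c*a≤d⇒a≤d/c (k^[b+1]≥1 k 1≤k) (FloorProduct.k^[b+1]*qr≤xy b x y 1≤k)

      ∣P*zetaTerm-p∣≤e : ∀ k → 1 ℕ.≤ k → ∣ P * zetaTerm b k - p k ∣ ≤ e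
      ∣P*zetaTerm-p∣≤e k 1≤k = begin
        ∣ P * zetaTerm b k - p k ∣   ≃⟨ 0≤p⇒∣p∣≃p (p≤q⇒0≤q-p (p≤P*zetaTerm k 1≤k)) ⟩
        P * zetaTerm b k - p k       ≤⟨ +-monoˡ-≤ (- p k) (d≤c*a⇒d/c≤a (k^[b+1]≥1 k 1≤k) (FloorProduct.xy≤k^[b+1]*[qr+x+y+1] b x y 1≤k)) ⟩
        fromℕ (⌊ x / k ⌋ ℕ.* ⌊ y / k ^ b ⌋ ℕ.+ (x ℕ.+ y ℕ.+ 1)) - p k ≃⟨ +-congˡ (- p k) (fromℕ-+ (⌊ x / k ⌋ ℕ.* ⌊ y / k ^ b ⌋) (x ℕ.+ y ℕ.+ 1)) ⟩
        p k + e - p k                ≃⟨ cancel (p k) e ⟩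
        e                            ∎
        where
        open ≤-Reasoning
        cancel : ∀ a c → a + c - a ≃ c
        cancel = solve 2 (λ a c → (a ⊕ c ⊖ a) ⊜ c) ≃-refl

      Kp*e≤P/K : fromℕ Kp * e ≤ P * 1/K
      Kp*e≤P/K = ≤-trans (≤-reflexive (≃-sym (fromℕ-* Kp (x ℕ.+ y ℕ.+ 1)))) (c*a≤d⇒a≤d/c 1≤K (begin
        K ℕ.* (Kp ℕ.* (x ℕ.+ y ℕ.+ 1))  ≤⟨ ℕ.*-monoʳ-≤ K (ℕ.*-monoˡ-≤ (x ℕ.+ y ℕ.+ 1) (ℕ.n≤1+n Kp)) ⟩
        K ℕ.* (K ℕ.* (x ℕ.+ y ℕ.+ 1))   ≡⟨ ℕ.*-assoc K K (x ℕ.+ y ℕ.+ 1) ⟨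
        K ℕ.* K ℕ.* (x ℕ.+ y ℕ.+ 1)     ≤⟨ K²[x+y+1]≤xy 1≤K (ℕ.≤-trans (3K²≤X (suc j)) X≤x) (ℕ.≤-trans (3K²≤X (suc j)) X≤y) ⟩
        x ℕ.* y                         ∎))
        where open ℕ.≤-Reasoning

      ∣E₁∣≤Z*[P/K] : ∣ E₁ ∣ ≤ Z * (P * 1/K)
      ∣E₁∣≤Z*[P/K] = begin
        ∣ E₁ ∣                       ≤⟨ ∣sumℚ∣≤sumℚ∣∣ Kp _ ⟩
        sumℚ Kp (λ i → ∣ P * zetaTerm b (1 ℕ.+ i) - p (1 ℕ.+ i) ∣) ≤⟨ sumℚ-mono-≤ Kp (λ i _ _ → ∣P*zetaTerm-p∣≤e (1 ℕ.+ i) (ℕ.s≤s ℕ.z≤n)) ⟩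
        sumℚ Kp (λ _ → e)            ≃⟨ sumℚ-const Kp e ⟩
        fromℕ Kp * e                 ≤⟨ Kp*e≤P/K ⟩
        P * 1/K                      ≃⟨ *-identityˡ _ ⟨
        1ℚᵘ * (P * 1/K)              ≤⟨ *-monoˡ-≤-≥0 (*-≥0 P≥0 (/ℕ-nonNeg 1 K)) Z≥1 ⟩
        Z * (P * 1/K)                ∎
        where open ≤-Reasoning

      ∣E₂∣≤θ*[Z*[P*3/4]] : ∣ E₂ ∣ ≤ θ j * (Z * (P * 3/4))
      ∣E₂∣≤θ*[Z*[P*3/4]] = begin
        ∣ E₂ ∣                                                    ≤⟨ ∣sumℚ∣≤sumℚ∣∣ Kp _ ⟩
        sumℚ Kp (λ i → ∣ Z * V (1 ℕ.+ i) - p (1 ℕ.+ i) ∣)         ≤⟨ sumℚ-mono-≤ Kp termwise ⟩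
        sumℚ Kp (λ i → θ j * (Z * (P * zetaTerm b (1 ℕ.+ i))))   ≃⟨ factor ⟨
        θ j * (Z * (P * W))                                       ≤⟨ *-monoʳ-≤-≥0 (θ-nonNeg j) (*-monoʳ-≤-≥0 Z≥0 (*-monoʳ-≤-≥0 P≥0 (ζ-from-2≤3/4 b Kp 1≤b))) ⟩
        θ j * (Z * (P * 3/4))                                     ∎
        where
        open ≤-Reasoning
        termwise : ∀ i → 1 ℕ.≤ i → i ℕ.≤ Kp → ∣ Z * V (1 ℕ.+ i) - p (1 ℕ.+ i) ∣ ≤ θ j * (Z * (P * zetaTerm b (1 ℕ.+ i)))
        termwise i _ i≤Kp = ≤-trans (IH (X≤⌊x/k⌋ j (ℕ.s≤s ℕ.z≤n) (ℕ.s≤s i≤Kp) X≤x) (X≤⌊y/kᵇ⌋ j (ℕ.s≤s ℕ.z≤n) (ℕ.s≤s i≤Kp) X≤y))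
                                    (*-monoʳ-≤-≥0 (θ-nonNeg j) (*-monoʳ-≤-≥0 Z≥0 (p≤P*zetaTerm (1 ℕ.+ i) (ℕ.s≤s ℕ.z≤n))))
        factor : θ j * (Z * (P * W)) ≃ sumℚ Kp (λ i → θ j * (Z * (P * zetaTerm b (1 ℕ.+ i))))
        factor = ≃-trans (*-congˡ {θ j} (≃-trans (*-congˡ {Z} (*-distribˡ-sumℚ Kp P _)) (*-distribˡ-sumℚ Kp Z _)))
                         (*-distribˡ-sumℚ Kp (θ j) _)

      S₃≤P/K : S₃ ≤ P * 1/K
      S₃≤P/K = begin
        S₃                                           ≤⟨ sumℚ-mono-≤ L (λ i _ _ → fromℕ-mono-≤ (countVisible≤ b ⌊ x / K ℕ.+ i ⌋ ⌊ y / (K ℕ.+ i) ^ b ⌋)) ⟩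
        sumℚ L (λ i → p (K ℕ.+ i))                   ≤⟨ sumℚ-mono-≤ L (λ i _ _ → p≤P*zetaTerm (K ℕ.+ i) (ℕ.s≤s ℕ.z≤n)) ⟩
        sumℚ L (λ i → P * zetaTerm b (K ℕ.+ i))      ≃⟨ *-distribˡ-sumℚ L P _ ⟨
        P * sumℚ L (λ i → zetaTerm b (K ℕ.+ i))      ≤⟨ *-monoʳ-≤-≥0 P≥0 (ζ-tail≤1/a b K L 1≤b 1≤K) ⟩
        P * 1/K                                      ∎
        where open ≤-Reasoning

      ∣E₃∣≤Z*[P/K] : ∣ E₃ ∣ ≤ Z * (P * 1/K)
      ∣E₃∣≤Z*[P/K] = ≤-trans (≤-reflexive (0≤p⇒∣p∣≃p (*-≥0 Z≥0 (sumℚ-nonNeg L λ i → fromℕ-nonNeg (countVisible b ⌊ x / K ℕ.+ i ⌋ ⌊ y / (K ℕ.+ i) ^ b ⌋))))) (*-monoʳ-≤-≥0 Z≥0 S₃≤P/K)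

      bound-suc : Bound (suc j) x y
      bound-suc = begin
        ∣ discrepancy x y ∣                                   ≃⟨ ∣-∣-cong discrepancy≃E₁-E₂-E₃ ⟩
        ∣ E₁ - E₂ - E₃ ∣                                      ≤⟨ ≤-trans (∣p-q∣≤∣p∣+∣q∣ (E₁ - E₂) E₃) (+-monoˡ-≤ ∣ E₃ ∣ (∣p-q∣≤∣p∣+∣q∣ E₁ E₂)) ⟩
        ∣ E₁ ∣ + ∣ E₂ ∣ + ∣ E₃ ∣                              ≤⟨ +-mono-≤ (+-mono-≤ ∣E₁∣≤Z*[P/K] ∣E₂∣≤θ*[Z*[P*3/4]]) ∣E₃∣≤Z*[P/K] ⟩
        Z * (P * 1/K) + θ j * (Z * (P * 3/4)) + Z * (P * 1/K) ≃⟨ collect Z P 1/K (θ j) 3/4 ⟩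
        θ (suc j) * (Z * P)                                   ∎
        where
        open ≤-Reasoning
        collect : ∀ z p q t c → z * (p * q) + t * (z * (p * c)) + z * (p * q) ≃ (c * t + (q + q)) * (z * p)
        collect = solve 5 (λ z p q t c → (z ⊗ (p ⊗ q) ⊕ t ⊗ (z ⊗ (p ⊗ c)) ⊕ z ⊗ (p ⊗ q)) ⊜ ((c ⊗ t ⊕ (q ⊕ q)) ⊗ (z ⊗ p))) ≃-refl

    bound : ∀ j {x y} → X j ℕ.≤ x → X j ℕ.≤ y → Bound j x y
    bound zero    {x} {y} _ _ = bound-zero x y
    bound (suc j) X≤x X≤y = Step.bound-suc j (bound j) X≤x X≤y

module Limit where

  open import Defs
  open VisibleCount using (countVisible; countVisible≤)
  open NeighbourSum using (Λ-sum-within)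
  open RationalTools
  open ZetaPartialSums
  open RelativeError
  open import Data.Nat as ℕ using (ℕ; zero; suc; _^_)
  import Data.Nat.Properties as ℕ
  open import Data.Nat.Tactic.RingSolver using () renaming (solve-∀ to solveℕ-∀)
  open import Data.Integer as ℤ using (+_; +[1+_]; -[1+_]; +≤+; +<+)
  import Data.Integer.Properties as ℤ
  open import Data.Product using (proj₁; proj₂)
  open import Data.Rational.Unnormalised hiding (_/_)
  open import Data.Rational.Unnormalised.Properties
  open import Relation.Binary.PropositionalEquality as ≡ using (_≡_)

  [3/4]^ : ℕ → ℚᵘ
  [3/4]^ zero    = 1ℚᵘ
  [3/4]^ (suc j) = 3 /ℕ 4 * [3/4]^ j

  [3/4]^-nonNeg : ∀ j → 0ℚᵘ ≤ [3/4]^ j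
  [3/4]^-nonNeg zero    = /ℕ-nonNeg 1 1
  [3/4]^-nonNeg (suc j) = *-≥0 (/ℕ-nonNeg 3 4) ([3/4]^-nonNeg j)

  [3/4]^≤1 : ∀ j → [3/4]^ j ≤ 1ℚᵘ
  [3/4]^≤1 zero    = ≤-refl
  [3/4]^≤1 (suc j) = ≤-trans (*-monoˡ-≤-≥0 ([3/4]^-nonNeg j) (/ℕ-mono-≤ 3 1 4 1 (ℕ.s≤s ℕ.z≤n) (ℕ.s≤s ℕ.z≤n) (ℕ.s≤s (ℕ.s≤s (ℕ.s≤s ℕ.z≤n)))))
                             (≤-trans (≤-reflexive (*-identityˡ _)) ([3/4]^≤1 j))

  3/4*c/n≤c/[1+n] : ∀ c {n} → 3 ℕ.≤ n → 3 /ℕ 4 * c /ℕ n ≤ c /ℕ suc n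
  3/4*c/n≤c/[1+n] c {n@(suc (suc (suc m)))} _ = ≤-trans (≤-reflexive (/ℕ-* 3 c 4 n (ℕ.s≤s ℕ.z≤n) (ℕ.s≤s ℕ.z≤n)))
    (/ℕ-mono-≤ (3 ℕ.* c) c (4 ℕ.* n) (suc n) (ℕ.s≤s ℕ.z≤n) (ℕ.s≤s ℕ.z≤n) (ℕ.≤-trans (ℕ.m≤m+n _ (c ℕ.* m)) (ℕ.≤-reflexive (lemma c m))))
    where
    lemma : ∀ c m → 3 ℕ.* c ℕ.* suc (suc (suc (suc m))) ℕ.+ c ℕ.* m ≡ c ℕ.* (4 ℕ.* suc (suc (suc m)))
    lemma = solveℕ-∀

  3/4*c/n≤c/[1+n] c {zero}             ()
  3/4*c/n≤c/[1+n] c {suc zero}         (ℕ.s≤s ())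
  3/4*c/n≤c/[1+n] c {suc (suc zero)}   (ℕ.s≤s (ℕ.s≤s ()))

  [3/4]^≤4/[1+j] : ∀ j → [3/4]^ j ≤ 4 /ℕ suc j
  [3/4]^≤4/[1+j] j@zero             = ≤-trans ([3/4]^≤1 j) (/ℕ-mono-≤ 1 4 1 (suc j) (ℕ.s≤s ℕ.z≤n) (ℕ.s≤s ℕ.z≤n) (ℕ.s≤s ℕ.z≤n))
  [3/4]^≤4/[1+j] j@(suc zero)       = ≤-trans ([3/4]^≤1 j) (/ℕ-mono-≤ 1 4 1 (suc j) (ℕ.s≤s ℕ.z≤n) (ℕ.s≤s ℕ.z≤n) (ℕ.s≤s (ℕ.s≤s ℕ.z≤n)))
  [3/4]^≤4/[1+j] j@(suc (suc zero)) = ≤-trans ([3/4]^≤1 j) (/ℕ-mono-≤ 1 4 1 (suc j) (ℕ.s≤s ℕ.z≤n) (ℕ.s≤s ℕ.z≤n) (ℕ.s≤s (ℕ.s≤s (ℕ.s≤s ℕ.z≤n))))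
  [3/4]^≤4/[1+j] (suc j@(suc (suc _))) =
    ≤-trans (*-monoʳ-≤-≥0 (/ℕ-nonNeg 3 4) ([3/4]^≤4/[1+j] j)) (3/4*c/n≤c/[1+n] 4 (ℕ.s≤s (ℕ.s≤s (ℕ.s≤s ℕ.z≤n))))

  recip-inverse : ∀ {p} → 1ℚᵘ ≤ p → p * recip p ≃ 1ℚᵘ
  recip-inverse {mkℚᵘ +[1+ n ] d} _ = *≡* (≡.trans (ℤ.*-identityʳ _)
    (≡.trans (≡.cong +_ (ℕ.*-comm (suc n) (suc d))) (≡.sym (ℤ.*-identityˡ _))))
  recip-inverse {mkℚᵘ (+ zero) d} (*≤* (+≤+ ()))
  recip-inverse {mkℚᵘ -[1+ n ] d} (*≤* ())

  recip-nonNeg : ∀ p → 0ℚᵘ ≤ recip p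
  recip-nonNeg (mkℚᵘ (+ zero) d)   = ≤-refl
  recip-nonNeg (mkℚᵘ +[1+ n ] d)   = /ℕ-nonNeg (suc d) (suc n)
  recip-nonNeg (mkℚᵘ -[1+ n ] d)   = ≤-refl

  1/↧ε≤ε : ∀ {ε} → 0ℚᵘ < ε → 1 /ℕ ↧ₙ ε ≤ ε
  1/↧ε≤ε {mkℚᵘ +[1+ n ] d} _ = /ℕ-mono-≤ 1 (suc n) (suc d) (suc d) (ℕ.s≤s ℕ.z≤n) (ℕ.s≤s ℕ.z≤n) (ℕ.*-monoˡ-≤ (suc d) {1} {suc n} (ℕ.s≤s ℕ.z≤n))
  1/↧ε≤ε {mkℚᵘ (+ zero) d} (*<* (+<+ ()))
  1/↧ε≤ε {mkℚᵘ -[1+ n ] d} (*<* ())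

  ∣p/q-r/s∣≤ : ∀ {p q q′ r s s′ B} → q * q′ ≃ 1ℚᵘ → s * s′ ≃ 1ℚᵘ → 0ℚᵘ ≤ q′ → 0ℚᵘ ≤ s′ →
               ∣ p * s - r * q ∣ ≤ s * q * B → ∣ p * q′ - r * s′ ∣ ≤ B
  ∣p/q-r/s∣≤ {p} {q} {q′} {r} {s} {s′} {B} qq′≃1 ss′≃1 0≤q′ 0≤s′ ∣ps-rq∣≤ = begin
    ∣ p * q′ - r * s′ ∣                    ≃⟨ ∣-∣-cong unscale ⟨
    ∣ (p * s - r * q) * (q′ * s′) ∣        ≃⟨ ∣p*q∣≃∣p∣*q (p * s - r * q) (*-≥0 0≤q′ 0≤s′) ⟩
    ∣ p * s - r * q ∣ * (q′ * s′)          ≤⟨ *-monoˡ-≤-≥0 (*-≥0 0≤q′ 0≤s′) ∣ps-rq∣≤ ⟩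
    s * q * B * (q′ * s′)                  ≃⟨ regroup s q B q′ s′ ⟩
    B * ((s * s′) * (q * q′))              ≃⟨ *-congˡ {B} (*-cong ss′≃1 qq′≃1) ⟩
    B * (1ℚᵘ * 1ℚᵘ)                        ≃⟨ *-identityʳ B ⟩
    B                                      ∎
    where
    open ≤-Reasoning
    factor : ∀ p q q′ r s s′ → (p * s - r * q) * (q′ * s′) ≃ p * q′ * (s * s′) - r * s′ * (q * q′)
    factor = solve 6 (λ p q q′ r s s′ → ((p ⊗ s ⊖ r ⊗ q) ⊗ (q′ ⊗ s′)) ⊜ (p ⊗ q′ ⊗ (s ⊗ s′) ⊖ r ⊗ s′ ⊗ (q ⊗ q′))) ≃-refl
    regroup : ∀ s q B q′ s′ → s * q * B * (q′ * s′) ≃ B * ((s * s′) * (q * q′))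
    regroup = solve 5 (λ s q B q′ s′ → (s ⊗ q ⊗ B ⊗ (q′ ⊗ s′)) ⊜ (B ⊗ ((s ⊗ s′) ⊗ (q ⊗ q′)))) ≃-refl
    unscale : (p * s - r * q) * (q′ * s′) ≃ p * q′ - r * s′
    unscale = begin-equality
      (p * s - r * q) * (q′ * s′)              ≃⟨ factor p q q′ r s s′ ⟩
      p * q′ * (s * s′) - r * s′ * (q * q′)    ≃⟨ +-cong (*-congˡ {p * q′} ss′≃1) (-‿cong (*-congˡ {r * s′} qq′≃1)) ⟩
      p * q′ * 1ℚᵘ - r * s′ * 1ℚᵘ              ≃⟨ +-cong (*-identityʳ (p * q′)) (-‿cong (*-identityʳ (r * s′))) ⟩
      p * q′ - r * s′                          ∎

  module Convergence (b : ℕ) (1≤b : 1 ℕ.≤ b) (M : ℕ) (1≤M : 1 ℕ.≤ M) where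

    -- Choose K, j and N₀ so that each of the three error terms below is at most 1/(4M).
    m₄ Kp j : ℕ
    m₄ = 4 ℕ.* M
    Kp = 36 ℕ.* m₄
    j = 16 ℕ.* m₄
    open Bootstrap b Kp 1≤b public

    N₀ : ℕ
    N₀ = X j ℕ.+ 4 ℕ.* m₄

    u four : ℚᵘ
    u = 1 /ℕ m₄
    four = fromℕ 4

    1≤m₄ : 1 ℕ.≤ m₄
    1≤m₄ = ℕ.*-mono-≤ (ℕ.s≤s (ℕ.z≤n {3})) 1≤M

    θ≤[3/4]^+8/K : ∀ i → θ i ≤ [3/4]^ i + fromℕ 8 * 1/K
    θ≤[3/4]^+8/K zero    = p≤p+q 1ℚᵘ (fromℕ 8 * 1/K) {{nonNegative (*-≥0 (fromℕ-nonNeg 8) (/ℕ-nonNeg 1 K))}}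
    θ≤[3/4]^+8/K (suc i) = begin
      3/4 * θ i + (1/K + 1/K)                              ≤⟨ +-monoˡ-≤ (1/K + 1/K) (*-monoʳ-≤-≥0 (/ℕ-nonNeg 3 4) (θ≤[3/4]^+8/K i)) ⟩
      3/4 * ([3/4]^ i + fromℕ 8 * 1/K) + (1/K + 1/K)       ≃⟨ expand ([3/4]^ i) 1/K 3/4 (fromℕ 8) ⟩
      3/4 * [3/4]^ i + (3/4 * fromℕ 8 + 1ℚᵘ + 1ℚᵘ) * 1/K   ≃⟨ +-congʳ (3/4 * [3/4]^ i) (*-congʳ {1/K} {3/4 * fromℕ 8 + 1ℚᵘ + 1ℚᵘ} {fromℕ 8} (*≡* ≡.refl)) ⟩
      [3/4]^ (suc i) + fromℕ 8 * 1/K                       ∎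
      where
      open ≤-Reasoning
      expand : ∀ r q c d → c * (r + d * q) + (q + q) ≃ c * r + (c * d + 1ℚᵘ + 1ℚᵘ) * q
      expand = solve 4 (λ r q c d → (c ⊗ (r ⊕ d ⊗ q) ⊕ (q ⊕ q)) ⊜ (c ⊗ r ⊕ (c ⊗ d ⊕ (Κ 1ℚᵘ) ⊕ (Κ 1ℚᵘ)) ⊗ q)) ≃-refl

    module AtN {N Kq : ℕ} (N₀≤N : N₀ ℕ.≤ N) (K≤Kq : K ℕ.≤ Kq) where

      X≤N : X j ℕ.≤ N
      X≤N = ℕ.≤-trans (ℕ.m≤m+n (X j) _) N₀≤N
      4m₄≤N : 4 ℕ.* m₄ ℕ.≤ N
      4m₄≤N = ℕ.≤-trans (ℕ.m≤n+m _ (X j)) N₀≤N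
      1≤N : 1 ℕ.≤ N
      1≤N = ℕ.≤-trans (ℕ.*-mono-≤ (ℕ.s≤s (ℕ.z≤n {3})) (ℕ.*-mono-≤ (ℕ.s≤s (ℕ.z≤n {3})) 1≤M)) 4m₄≤N

      Q v A 1/N Zk T B : ℚᵘ
      Q = fromℕ (N ℕ.* N)
      v = fromℕ (countVisible b N N)
      A = fromℕ (SumΛ b N)
      1/N = 1 /ℕ N
      Zk = ζ b Kq
      T = sumℚ (Kq ℕ.∸ K) (λ i → zetaTerm b (K ℕ.+ i))
      B = four * 1/N + four * 1/K + four * θ j

      Q≥0 : 0ℚᵘ ≤ Q
      Q≥0 = fromℕ-nonNeg (N ℕ.* N)
      T≥0 : 0ℚᵘ ≤ T
      T≥0 = sumℚ-nonNeg (Kq ℕ.∸ K) λ i → zetaTerm-nonNeg b (K ℕ.+ i)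
      four≥0 : 0ℚᵘ ≤ four
      four≥0 = fromℕ-nonNeg 4

      Zk≃Z+T : Zk ≃ Z + T
      Zk≃Z+T = ≃-trans (≃-reflexive (≡.cong (λ n → sumℚ n (zetaTerm b)) (≡.sym (ℕ.m+[n∸m]≡n K≤Kq)))) (sumℚ-split K (Kq ℕ.∸ K) (zetaTerm b))
      Z≤Zk : Z ≤ Zk
      Z≤Zk = ≤-trans (p≤p+q Z T {{nonNegative T≥0}}) (≤-reflexive (≃-sym Zk≃Z+T))
      Zk≥1 : 1ℚᵘ ≤ Zk
      Zk≥1 = ≤-trans Z≥1 Z≤Zk
      Zk≥0 : 0ℚᵘ ≤ Zk
      Zk≥0 = ≤-trans (*≤* (+≤+ ℕ.z≤n)) Zk≥1

      N≃Q*1/N : fromℕ N ≃ Q * 1/N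
      N≃Q*1/N = begin-equality
        fromℕ N                        ≃⟨ *-identityʳ (fromℕ N) ⟨
        fromℕ N * 1ℚᵘ                  ≃⟨ *-congˡ {fromℕ N} (n*[1/n]≃1 1≤N) ⟨
        fromℕ N * (fromℕ N * 1/N)      ≃⟨ *-assoc (fromℕ N) (fromℕ N) 1/N ⟨
        fromℕ N * fromℕ N * 1/N        ≃⟨ *-congʳ {1/N} (fromℕ-* N N) ⟨
        Q * 1/N                        ∎
        where open ≤-Reasoning

      ∣A-4v∣≤4N : ∣ A - four * v ∣ ≤ four * fromℕ N
      ∣A-4v∣≤4N = begin
        ∣ A - four * v ∣                                ≃⟨ ∣-∣-cong (+-congʳ A (-‿cong (fromℕ-* 4 (countVisible b N N)))) ⟨
        ∣ A - fromℕ (4 ℕ.* countVisible b N N) ∣        ≤⟨ ∣fromℕ-fromℕ∣≤ (proj₁ (Λ-sum-within b N)) (proj₂ (Λ-sum-within b N)) ⟩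
        fromℕ (4 ℕ.* N)                                 ≃⟨ fromℕ-* 4 N ⟩
        four * fromℕ N                                  ∎
        where open ≤-Reasoning

      X₁ X₂ X₃ : ℚᵘ
      X₁ = Zk * (A - four * v)
      X₂ = four * (T * v)
      X₃ = four * discrepancy N N

      -- The three summands: SumΛ against 4V, the tail of ζ beyond K, and the bootstrap error.
      A*Zk-4Q≃X₁+X₂+X₃ : A * Zk - four * Q ≃ X₁ + X₂ + X₃
      A*Zk-4Q≃X₁+X₂+X₃ = begin-equality
        A * Zk - four * Q                                       ≃⟨ +-congˡ (- (four * Q)) (*-congˡ {A} Zk≃Z+T) ⟩
        A * (Z + T) - four * Q                                  ≃⟨ regroup A Z T four Q v ⟩
        (Z + T) * (A - four * v) + X₂ + X₃                      ≃⟨ +-congˡ X₃ (+-congˡ X₂ (*-congʳ {A - four * v} Zk≃Z+T)) ⟨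
        X₁ + X₂ + X₃                                            ∎
        where
        open ≤-Reasoning
        regroup : ∀ a z t c q v → a * (z + t) - c * q ≃ (z + t) * (a - c * v) + c * (t * v) + c * (z * v - q)
        regroup = solve 6 (λ a z t c q v → (a ⊗ (z ⊕ t) ⊖ c ⊗ q) ⊜ ((z ⊕ t) ⊗ (a ⊖ c ⊗ v) ⊕ c ⊗ (t ⊗ v) ⊕ c ⊗ (z ⊗ v ⊖ q))) ≃-refl

      ∣X₁∣≤Zk*Q*[4/N] : ∣ X₁ ∣ ≤ Zk * Q * (four * 1/N)
      ∣X₁∣≤Zk*Q*[4/N] = begin
        ∣ Zk * (A - four * v) ∣               ≃⟨ ≃-trans (∣p*q∣≃∣p∣*∣q∣ Zk (A - four * v)) (*-congʳ {∣ A - four * v ∣} (0≤p⇒∣p∣≃p Zk≥0)) ⟩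
        Zk * ∣ A - four * v ∣                 ≤⟨ *-monoʳ-≤-≥0 Zk≥0 ∣A-4v∣≤4N ⟩
        Zk * (four * fromℕ N)                 ≃⟨ *-congˡ {Zk} (*-congˡ {four} N≃Q*1/N) ⟩
        Zk * (four * (Q * 1/N))               ≃⟨ reorder Zk four Q 1/N ⟩
        Zk * Q * (four * 1/N)                 ∎
        where
        open ≤-Reasoning
        reorder : ∀ z c q f → z * (c * (q * f)) ≃ z * q * (c * f)
        reorder = solve 4 (λ z c q f → (z ⊗ (c ⊗ (q ⊗ f))) ⊜ (z ⊗ q ⊗ (c ⊗ f))) ≃-refl

      ∣X₂∣≤Zk*Q*[4/K] : ∣ X₂ ∣ ≤ Zk * Q * (four * 1/K)
      ∣X₂∣≤Zk*Q*[4/K] = begin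
        ∣ four * (T * v) ∣                    ≃⟨ 0≤p⇒∣p∣≃p (*-≥0 four≥0 (*-≥0 T≥0 (fromℕ-nonNeg _))) ⟩
        four * (T * v)                        ≤⟨ *-monoʳ-≤-≥0 four≥0 (≤-trans (*-monoˡ-≤-≥0 (fromℕ-nonNeg _) (ζ-tail≤1/a b K (Kq ℕ.∸ K) 1≤b 1≤K))
                                                                              (*-monoʳ-≤-≥0 (/ℕ-nonNeg 1 K) (fromℕ-mono-≤ (countVisible≤ b N N)))) ⟩
        four * (1/K * Q)                      ≃⟨ reorder four Q 1/K ⟩
        1ℚᵘ * Q * (four * 1/K)                ≤⟨ *-monoˡ-≤-≥0 (*-≥0 four≥0 (/ℕ-nonNeg 1 K)) (*-monoˡ-≤-≥0 Q≥0 Zk≥1) ⟩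
        Zk * Q * (four * 1/K)                 ∎
        where
        open ≤-Reasoning
        reorder : ∀ c q f → c * (f * q) ≃ 1ℚᵘ * q * (c * f)
        reorder = solve 3 (λ c q f → (c ⊗ (f ⊗ q)) ⊜ ((Κ 1ℚᵘ) ⊗ q ⊗ (c ⊗ f))) ≃-refl

      ∣X₃∣≤Zk*Q*[4θ] : ∣ X₃ ∣ ≤ Zk * Q * (four * θ j)
      ∣X₃∣≤Zk*Q*[4θ] = begin
        ∣ four * discrepancy N N ∣            ≃⟨ ≃-trans (∣p*q∣≃∣p∣*∣q∣ four (discrepancy N N)) (*-congʳ {∣ discrepancy N N ∣} (0≤p⇒∣p∣≃p four≥0)) ⟩
        four * ∣ discrepancy N N ∣            ≤⟨ *-monoʳ-≤-≥0 four≥0 (bound j X≤N X≤N) ⟩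
        four * (θ j * (Z * Q))                ≃⟨ reorder four (θ j) Z Q ⟩
        Z * Q * (four * θ j)                  ≤⟨ *-monoˡ-≤-≥0 (*-≥0 four≥0 (θ-nonNeg j)) (*-monoˡ-≤-≥0 Q≥0 Z≤Zk) ⟩
        Zk * Q * (four * θ j)                 ∎
        where
        open ≤-Reasoning
        reorder : ∀ c t z q → c * (t * (z * q)) ≃ z * q * (c * t)
        reorder = solve 4 (λ c t z q → (c ⊗ (t ⊗ (z ⊗ q))) ⊜ (z ⊗ q ⊗ (c ⊗ t))) ≃-refl

      ∣A*Zk-4Q∣≤Zk*Q*B : ∣ A * Zk - four * Q ∣ ≤ Zk * Q * B
      ∣A*Zk-4Q∣≤Zk*Q*B = begin
        ∣ A * Zk - four * Q ∣                                        ≃⟨ ∣-∣-cong A*Zk-4Q≃X₁+X₂+X₃ ⟩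
        ∣ X₁ + X₂ + X₃ ∣                                             ≤⟨ ≤-trans (∣p+q∣≤∣p∣+∣q∣ (X₁ + X₂) X₃) (+-monoˡ-≤ ∣ X₃ ∣ (∣p+q∣≤∣p∣+∣q∣ X₁ X₂)) ⟩
        ∣ X₁ ∣ + ∣ X₂ ∣ + ∣ X₃ ∣                                     ≤⟨ +-mono-≤ (+-mono-≤ ∣X₁∣≤Zk*Q*[4/N] ∣X₂∣≤Zk*Q*[4/K]) ∣X₃∣≤Zk*Q*[4θ] ⟩
        Zk * Q * (four * 1/N) + Zk * Q * (four * 1/K) + Zk * Q * (four * θ j) ≃⟨ distrib (Zk * Q) (four * 1/N) (four * 1/K) (four * θ j) ⟩
        Zk * Q * B                                                   ∎
        where
        open ≤-Reasoning
        distrib : ∀ p x y z → p * x + p * y + p * z ≃ p * (x + y + z)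
        distrib = solve 4 (λ p x y z → (p ⊗ x ⊕ p ⊗ y ⊕ p ⊗ z) ⊜ (p ⊗ (x ⊕ y ⊕ z))) ≃-refl

      B≤3u : B ≤ u + u + u
      B≤3u = begin
        four * 1/N + four * 1/K + four * θ j
          ≤⟨ +-monoʳ-≤ (four * 1/N + four * 1/K) (*-monoʳ-≤-≥0 four≥0 (θ≤[3/4]^+8/K j)) ⟩
        four * 1/N + four * 1/K + four * ([3/4]^ j + fromℕ 8 * 1/K)
          ≃⟨ regroup four (fromℕ 8) 1/N 1/K ([3/4]^ j) ⟩
        four * 1/N + (four + four * fromℕ 8) * 1/K + four * [3/4]^ j
          ≃⟨ +-congˡ (four * [3/4]^ j) (+-congʳ (four * 1/N) (*-congʳ {1/K} {four + four * fromℕ 8} {fromℕ 36} (*≡* ≡.refl))) ⟩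
        four * 1/N + fromℕ 36 * 1/K + four * [3/4]^ j
          ≤⟨ +-mono-≤ (+-mono-≤ 4/N≤u 36/K≤u) 4*[3/4]^j≤u ⟩
        u + u + u ∎
        where
        open ≤-Reasoning
        regroup : ∀ c d f q r → c * f + c * q + c * (r + d * q) ≃ c * f + (c + c * d) * q + c * r
        regroup = solve 5 (λ c d f q r → (c ⊗ f ⊕ c ⊗ q ⊕ c ⊗ (r ⊕ d ⊗ q)) ⊜ (c ⊗ f ⊕ (c ⊕ c ⊗ d) ⊗ q ⊕ c ⊗ r)) ≃-refl
        4/N≤u : four * 1/N ≤ u
        4/N≤u = ≤-trans (≤-reflexive (fromℕ-*-/ℕ 4 1 1≤N))
                        (/ℕ-mono-≤ 4 1 N m₄ 1≤N 1≤m₄ (ℕ.≤-trans 4m₄≤N (ℕ.≤-reflexive (≡.sym (ℕ.*-identityˡ N)))))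
        36/K≤u : fromℕ 36 * 1/K ≤ u
        36/K≤u = ≤-trans (≤-reflexive (fromℕ-*-/ℕ 36 1 1≤K))
                         (/ℕ-mono-≤ 36 1 K m₄ 1≤K 1≤m₄ (ℕ.≤-trans (ℕ.n≤1+n _) (ℕ.≤-reflexive (≡.sym (ℕ.*-identityˡ K)))))
        4*[3/4]^j≤u : four * [3/4]^ j ≤ u
        4*[3/4]^j≤u = ≤-trans (*-monoʳ-≤-≥0 four≥0 ([3/4]^≤4/[1+j] j))
                      (≤-trans (≤-reflexive (fromℕ-*-/ℕ 4 4 (ℕ.s≤s ℕ.z≤n)))
                        (/ℕ-mono-≤ 16 1 (suc j) m₄ (ℕ.s≤s ℕ.z≤n) 1≤m₄ (ℕ.≤-trans (ℕ.n≤1+n _) (ℕ.≤-reflexive (≡.sym (ℕ.*-identityˡ (suc j)))))))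

      3u<1/M : u + u + u < 1 /ℕ M
      3u<1/M = ≤-<-trans (≤-reflexive (≃-trans (triple u) (≃-trans (*-congʳ {u} {1ℚᵘ + 1ℚᵘ + 1ℚᵘ} {fromℕ 3} (*≡* ≡.refl)) (fromℕ-*-/ℕ 3 1 1≤m₄))))
                         (/ℕ-mono-< 3 1 m₄ M 1≤m₄ 1≤M (≡.subst (3 ℕ.* M ℕ.<_) (≡.sym (ℕ.*-identityˡ m₄)) (ℕ.*-monoˡ-< M {{ℕ.>-nonZero 1≤M}} (ℕ.n<1+n 3))))
        where
        triple : ∀ x → x + x + x ≃ (1ℚᵘ + 1ℚᵘ + 1ℚᵘ) * x
        triple = solve 1 (λ x → (x ⊕ x ⊕ x) ⊜ (((Κ 1ℚᵘ) ⊕ (Κ 1ℚᵘ) ⊕ (Κ 1ℚᵘ)) ⊗ x)) ≃-refl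

      avgΛ-close : ∣ avgΛ b N - fourOverZetaPartial b Kq ∣ < 1 /ℕ M
      avgΛ-close = begin-strict
        ∣ avgΛ b N - fourOverZetaPartial b Kq ∣           ≃⟨ ∣-∣-cong (+-cong avgΛ≃ (-‿cong (≃-reflexive (≡.cong (λ z → four * recip z) (zetaPartial≡ζ b Kq))))) ⟩
        ∣ A * 1 /ℕ (N ℕ.* N) - four * recip Zk ∣          ≤⟨ ∣p/q-r/s∣≤ {A} {Q} {1 /ℕ (N ℕ.* N)} {four} {Zk} {recip Zk} (n*[1/n]≃1 1≤N²) (recip-inverse Zk≥1) (/ℕ-nonNeg 1 (N ℕ.* N)) (recip-nonNeg Zk) ∣A*Zk-4Q∣≤Zk*Q*B ⟩
        B                                                 ≤⟨ B≤3u ⟩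
        u + u + u                                         <⟨ 3u<1/M ⟩
        1 /ℕ M                                            ∎
        where
        open ≤-Reasoning
        1≤N² : 1 ℕ.≤ N ℕ.* N
        1≤N² = ℕ.*-mono-≤ 1≤N 1≤N
        avgΛ≃ : avgΛ b N ≃ A * 1 /ℕ (N ℕ.* N)
        avgΛ≃ = ≃-sym (≃-trans (fromℕ-*-/ℕ (SumΛ b N) 1 1≤N²) (≃-reflexive (≡.cong (_/ℕ (N ℕ.* N)) (ℕ.*-identityʳ (SumΛ b N)))))

open import Defs
open import Data.Nat using (ℕ; _≤_; s≤s; z≤n)
open import Data.Product using (∃₂; _,_)
open import Data.Rational.Unnormalised using (ℚᵘ; 0ℚᵘ; _<_; _-_; ∣_∣; ↧ₙ_)
open import Data.Rational.Unnormalised.Properties using (<-≤-trans)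
open Limit using (1/↧ε≤ε; module Convergence)

mainTheorem7 : (b : ℕ) → 1 ≤ b →
    (ε : ℚᵘ) → 0ℚᵘ < ε →
      ∃₂ λ N₀ K₀ → (N K : ℕ) → N₀ ≤ N → K₀ ≤ K →
        ∣ avgΛ b N - fourOverZetaPartial b K ∣ < ε
mainTheorem7 b 1≤b ε 0<ε = N₀ , K , λ N K′ N₀≤N K≤K′ → <-≤-trans (AtN.avgΛ-close N₀≤N K≤K′) (1/↧ε≤ε 0<ε)
  where open Convergence b 1≤b (↧ₙ ε) (s≤s z≤n)
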